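{- Let $k=2K+1\geq5$ be an odd integer and $i$ an integer with $0\le i\le k-2$. Define $$F_k^{(i)}(x,y)=\sum_{s=1}^{K-1}\left(\frac{ -2}{2s-1}\sum_{n=0}^{k-2s}\binom{i}{k-2s-n}\binom{n+2s-2}{n}B_n\right)x^{2K-2s}y^{2s-1},$$ $$G_k^{(i)}(x,y)=\sum_{s=1}^{K-1}\left(\frac{2}{2s-1}\sum_{n=0}^{k-2s}\binom{k-2-i}{k-2s-n}\binom{n+2s-2}{n}B_n\right)x^{2K-2s}y^{2s-1},$$ $$R_k^{(i)}(x,y)=-\frac{k-2-2i}{k-2}x^{k-2}+(-1)^ix^{k-2-i}y^i+(-1)^ix^iy^{k-2-i}-\frac{k-2-2i}{k-2}y^{k-2}.$$ Then $$F_k^{(i)}(x+y,x)+F_k^{(i)}(x+y,y)=R_k^{(i)}(x,y)\quad\text{and}\quad G_k^{(i)}(x+y,x)+G_k^{(i)}(x+y,y)=R_k^{(i)}(x,y).$$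
   Context: $B_n$ is the $n$th Bernoulli number, defined by $\frac{t}{e^t-1}=\sum_{n\ge0}B_n\frac{t^n}{n!}$ (so $B_1=-\tfrac12$). Binomial coefficients $\binom{a}{m}$ with $a\ge0$ are the usual ones, equal to $0$ when $m<0$ or $m>a$. All identities are identities of polynomials in $x,y$ with rational coefficients. -}

module Defs where

open import Data.Nat as ℕ using (ℕ; zero; suc; _∸_; _≤ᵇ_)
open import Data.Nat.Combinatorics using (_C_)
open import Data.Integer as ℤ using (ℤ; +_)
open import Data.Rational using (ℚ; _+_; _*_; -_; _/_; 0ℚ; 1ℚ)
open import Data.Bool using (if_then_else_)

sumTo : ℕ → (ℕ → ℚ) → ℚ
sumTo zero    f = 0ℚ
sumTo (suc n) f = sumTo n f + f n

pow : ℚ → ℕ → ℚ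
pow x zero    = 1ℚ
pow x (suc n) = x * pow x n

ℕtoℚ : ℕ → ℚ
ℕtoℚ n = (+ n) / 1

-- a / d, with the (never used) convention a / 0 = 0
frac : ℤ → ℕ → ℚ
frac a zero    = 0ℚ
frac a (suc d) = a / suc d

-- bernUpTo m j = B_j for j ≤ m, via the recurrence equivalent to
-- t/(e^t - 1) = Σ B_n t^n/n!  (so B_1 = -1/2):
--   B_0 = 1,  B_{m+1} = -1/(m+2) Σ_{j=0}^{m} C(m+2, j) B_j.
bernUpTo : ℕ → ℕ → ℚ
bernUpTo zero    j = 1ℚ
bernUpTo (suc m) j =
  if j ≤ᵇ m then bernUpTo m j
  else (- frac (+ 1) (suc (suc m)))
         * sumTo (suc m) (λ l → ℕtoℚ (suc (suc m) C l) * bernUpTo m l)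

B : ℕ → ℚ
B n = bernUpTo n n

kOf : ℕ → ℕ
kOf K = suc (2 ℕ.* K)

inner : ℕ → ℕ → ℕ → ℚ
inner k a s =
  sumTo (suc (k ∸ 2 ℕ.* s))
    (λ n → ℕtoℚ (a C (k ∸ 2 ℕ.* s ∸ n)) * ℕtoℚ ((n ℕ.+ 2 ℕ.* s ∸ 2) C n) * B n)

F : ℕ → ℕ → ℚ → ℚ → ℚ
F K i x y = sumTo (K ∸ 1) λ j → let s = suc j in
  (frac (ℤ.- (+ 2)) (2 ℕ.* s ∸ 1) * inner (kOf K) i s)
    * pow x (2 ℕ.* K ∸ 2 ℕ.* s) * pow y (2 ℕ.* s ∸ 1)

G : ℕ → ℕ → ℚ → ℚ → ℚ
G K i x y = sumTo (K ∸ 1) λ j → let s = suc j in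
  (frac (+ 2) (2 ℕ.* s ∸ 1) * inner (kOf K) (kOf K ∸ 2 ∸ i) s)
    * pow x (2 ℕ.* K ∸ 2 ℕ.* s) * pow y (2 ℕ.* s ∸ 1)

sgn : ℕ → ℚ
sgn i = pow (- 1ℚ) i

R : ℕ → ℕ → ℚ → ℚ → ℚ
R K i x y =
  let k = kOf K
      c = frac ((+ (k ∸ 2)) ℤ.- (+ (2 ℕ.* i))) (k ∸ 2)
  in (- c) * pow x (k ∸ 2)
     + sgn i * pow x (k ∸ 2 ∸ i) * pow y i
     + sgn i * pow x i * pow y (k ∸ 2 ∸ i)
     - c * pow y (k ∸ 2)
  where open import Data.Rational using (_-_)

{-# OPTIONS --safe #-}
-- Write d = k − 2 = 2L + 1 and 𝔹 N X Y = X^N B_N(Y/X). Reindexing s = j + 1, reversing the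
-- inner sum and exchanging the two sums turns F(x+y,x) + F(x+y,y) into −2 Σ_u C(i,u) S(d−u), where
-- S(J) = Σ_{j<L} C(J,2j) B_{J−2j}/(2j+1) · (x+y)^{2L−2j} (x^{2j+1} + y^{2j+1}).
-- For odd J only the term with J − 2j = 1 survives, because B_{2m+1} = 0 for m ≥ 1. For even J,
-- (J+1) S(J) is (x+y)^{2L−J} times the odd-index part of 𝔹_{J+1}(x+y, x) + 𝔹_{J+1}(x+y, y), which the reflection
-- 𝔹_N(x+y, x) = (−1)^N 𝔹_N(x+y, y) evaluates. Either way S(d−u) = −½(−1)^u (x+y)^u (x^{d−u} + y^{d−u})
-- up to corrections at u = 0, 1, and the binomial theorem Σ_u C(i,u) (−1)^u (x+y)^u x^{d−u} = (−1)^i x^{d−i} y^i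
-- yields R. The G identity follows from G^{(i)} = −F^{(d−i)} and R^{(d−i)} = −R^{(i)}.
-- The Bernoulli facts used (addition formula, B_N(Y+1) − B_N(Y) = N Y^{N−1}, (−1)^n B_n = B_n(1) and
-- reflection) all follow from the defining recurrence Σ_{l<p} C(p,l) B_l = [p = 1].
module Submission where

open import Defs
open import Data.Nat as ℕ using (ℕ; zero; suc; _∸_; _≤_; _<_; z≤n; s≤s; _!; _≤ᵇ_)
import Data.Nat.Properties as ℕP
open import Data.Nat.Combinatorics
  using (_C_; nCk+nC[k+1]≡[n+1]C[k+1]; nCk≡nC[n∸k]; nCn≡1; nC1≡n; k>n⇒nCk≡0; nCk≡n!/k![n-k]!; k![n∸k]!∣n!)
open import Data.Nat.DivMod using (m/n*n≡m)
open import Data.Nat.Tactic.RingSolver using (solve-∀)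
open import Data.Integer as ℤ using (+_)
import Data.Integer.Properties as ℤP
open import Data.Rational using (ℚ; _+_; _*_; -_; _-_; _/_; 0ℚ; 1ℚ; fromℚᵘ)
import Data.Rational.Properties as ℚP
open import Data.Rational.Unnormalised as ℚᵘ using (mkℚᵘ; *≡*)
import Data.Rational.Unnormalised.Properties as ℚᵘP
open import Data.Rational.Solver using (module +-*-Solver)
open import Algebra.Properties.Group ℚP.+-0-group using (∙-cancelˡ; ∙-cancelʳ)
open import Data.Bool using (true; false; T; if_then_else_)
open import Data.Empty using (⊥-elim)
open import Data.Product using (_×_; _,_)
open import Data.Sum using (inj₁; inj₂; [_,_]′)
open import Relation.Binary.PropositionalEquality
open import Relation.Binary.Definitions using (Tri; tri<; tri≈; tri>)
open import Relation.Nullary using (¬_)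

open +-*-Solver

-- Natural numbers in ℚ

fromℚᵘ-homo-+ : ∀ p r → fromℚᵘ (p ℚᵘ.+ r) ≡ fromℚᵘ p + fromℚᵘ r
fromℚᵘ-homo-+ p r = ℚP.toℚᵘ-injective
  (ℚᵘP.≃-trans (ℚP.toℚᵘ-fromℚᵘ (p ℚᵘ.+ r))
   (ℚᵘP.≃-sym (ℚᵘP.≃-trans (ℚP.toℚᵘ-homo-+ (fromℚᵘ p) (fromℚᵘ r))
     (ℚᵘP.+-cong (ℚP.toℚᵘ-fromℚᵘ p) (ℚP.toℚᵘ-fromℚᵘ r)))))

fromℚᵘ-homo-* : ∀ p r → fromℚᵘ (p ℚᵘ.* r) ≡ fromℚᵘ p * fromℚᵘ r
fromℚᵘ-homo-* p r = ℚP.toℚᵘ-injective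
  (ℚᵘP.≃-trans (ℚP.toℚᵘ-fromℚᵘ (p ℚᵘ.* r))
   (ℚᵘP.≃-sym (ℚᵘP.≃-trans (ℚP.toℚᵘ-homo-* (fromℚᵘ p) (fromℚᵘ r))
     (ℚᵘP.*-cong (ℚP.toℚᵘ-fromℚᵘ p) (ℚP.toℚᵘ-fromℚᵘ r)))))

fromℚᵘ-cross : ∀ p r → ℚᵘ.↥ p ℤ.* ℚᵘ.↧ r ≡ ℚᵘ.↥ r ℤ.* ℚᵘ.↧ p → fromℚᵘ p ≡ fromℚᵘ r
fromℚᵘ-cross p r e = ℚP.fromℚᵘ-cong {p} {r} (*≡* e)

ℕtoℚ-+ : ∀ a b → ℕtoℚ (a ℕ.+ b) ≡ ℕtoℚ a + ℕtoℚ b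
ℕtoℚ-+ a b = trans (fromℚᵘ-cross (mkℚᵘ (+ (a ℕ.+ b)) 0) (mkℚᵘ (+ a) 0 ℚᵘ.+ mkℚᵘ (+ b) 0) cross)
                   (fromℚᵘ-homo-+ (mkℚᵘ (+ a) 0) (mkℚᵘ (+ b) 0))
  where
  cross : + (a ℕ.+ b) ℤ.* + 1 ≡ (+ a ℤ.* + 1 ℤ.+ + b ℤ.* + 1) ℤ.* + 1
  cross = cong (ℤ._* + 1) (sym (cong₂ ℤ._+_ (ℤP.*-identityʳ (+ a)) (ℤP.*-identityʳ (+ b))))

ℕtoℚ-* : ∀ a b → ℕtoℚ (a ℕ.* b) ≡ ℕtoℚ a * ℕtoℚ b
ℕtoℚ-* a b = trans (fromℚᵘ-cross (mkℚᵘ (+ (a ℕ.* b)) 0) (mkℚᵘ (+ a) 0 ℚᵘ.* mkℚᵘ (+ b) 0) cross)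
                   (fromℚᵘ-homo-* (mkℚᵘ (+ a) 0) (mkℚᵘ (+ b) 0))
  where
  cross : + (a ℕ.* b) ℤ.* + 1 ≡ (+ a ℤ.* + b) ℤ.* + 1
  cross = cong (ℤ._* + 1) (ℤP.pos-* a b)

1/ℕ : ℕ → ℚ
1/ℕ = frac (+ 1)

1/ℕ-inverseˡ : ∀ n → 1/ℕ (suc n) * ℕtoℚ (suc n) ≡ 1ℚ
1/ℕ-inverseˡ n = trans (sym (fromℚᵘ-homo-* (mkℚᵘ (+ 1) n) (mkℚᵘ (+ suc n) 0)))
  (fromℚᵘ-cross (mkℚᵘ (+ 1) n ℚᵘ.* mkℚᵘ (+ suc n) 0) (mkℚᵘ (+ 1) 0) cross)
  where
  cross : (+ 1 ℤ.* + suc n) ℤ.* + 1 ≡ + 1 ℤ.* + (suc n ℕ.* 1)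
  cross = trans (ℤP.*-identityʳ _) (trans (ℤP.*-identityˡ _)
            (cong (λ m → + suc m) (sym (trans (ℕP.+-identityʳ _) (ℕP.*-identityʳ n)))))

1/ℕ-cancelˡ : ∀ n c → 1/ℕ (suc n) * (ℕtoℚ (suc n) * c) ≡ c
1/ℕ-cancelˡ n c = trans (sym (ℚP.*-assoc (1/ℕ (suc n)) (ℕtoℚ (suc n)) c))
                        (trans (cong (_* c) (1/ℕ-inverseˡ n)) (ℚP.*-identityˡ c))

ℕtoℚ-cancelˡ : ∀ n {a b} → ℕtoℚ (suc n) * a ≡ ℕtoℚ (suc n) * b → a ≡ b
ℕtoℚ-cancelˡ n {a} {b} e =
  trans (sym (1/ℕ-cancelˡ n a)) (trans (cong (1/ℕ (suc n) *_) e) (1/ℕ-cancelˡ n b))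

frac-split : ∀ z n → frac z (suc n) ≡ (z / 1) * 1/ℕ (suc n)
frac-split z n = trans (fromℚᵘ-cross (mkℚᵘ z n) (mkℚᵘ z 0 ℚᵘ.* mkℚᵘ (+ 1) n) cross)
                       (fromℚᵘ-homo-* (mkℚᵘ z 0) (mkℚᵘ (+ 1) n))
  where
  cross : z ℤ.* + (1 ℕ.* suc n) ≡ (z ℤ.* + 1) ℤ.* + suc n
  cross = trans (cong (λ w → z ℤ.* + w) (ℕP.*-identityˡ (suc n))) (cong (ℤ._* + suc n) (sym (ℤP.*-identityʳ z)))

frac-neg : ∀ a n → frac (ℤ.- + suc a) n ≡ - frac (+ suc a) n
frac-neg a zero    = refl
frac-neg a (suc n) = refl

/1-homo-∸ : ∀ a b → (+ a ℤ.- + b) / 1 ≡ ℕtoℚ a - ℕtoℚ b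
/1-homo-∸ a b = trans (fromℚᵘ-cross (mkℚᵘ (+ a ℤ.- + b) 0) (mkℚᵘ (+ a) 0 ℚᵘ.+ mkℚᵘ (ℤ.- + b) 0) cross)
  (trans (fromℚᵘ-homo-+ (mkℚᵘ (+ a) 0) (mkℚᵘ (ℤ.- + b) 0)) (cong (λ w → ℕtoℚ a + w) (neg b)))
  where
  cross : (+ a ℤ.- + b) ℤ.* + 1 ≡ (+ a ℤ.* + 1 ℤ.+ (ℤ.- + b) ℤ.* + 1) ℤ.* + 1
  cross = cong (ℤ._* + 1) (sym (cong₂ ℤ._+_ (ℤP.*-identityʳ (+ a)) (ℤP.*-identityʳ (ℤ.- + b))))
  neg : ∀ b → (ℤ.- + b) / 1 ≡ - ℕtoℚ b
  neg zero    = refl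
  neg (suc b) = refl

-- Doubling and finite sums

double : ℕ → ℕ
double zero    = zero
double (suc n) = suc (suc (double n))

n+n≡double : ∀ n → n ℕ.+ n ≡ double n
n+n≡double zero    = refl
n+n≡double (suc n) = cong suc (trans (ℕP.+-suc n n) (cong suc (n+n≡double n)))

2*≡double : ∀ n → 2 ℕ.* n ≡ double n
2*≡double zero    = refl
2*≡double (suc n) = cong suc (trans (ℕP.+-suc n (n ℕ.+ 0)) (cong suc (trans (cong (n ℕ.+_) (ℕP.+-identityʳ n)) (n+n≡double n))))

double-∸ : ∀ m n → double m ∸ double n ≡ double (m ∸ n)
double-∸ zero    zero    = refl
double-∸ zero    (suc n) = refl
double-∸ (suc m) zero    = refl
double-∸ (suc m) (suc n) = double-∸ m n

1+double-∸ : ∀ {m n} → n ≤ m → suc (double m) ∸ double n ≡ suc (double (m ∸ n))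
1+double-∸ {m}     {zero}  _         = refl
1+double-∸ {suc m} {suc n} (s≤s n≤m) = 1+double-∸ n≤m

double-mono-≤ : ∀ {m n} → m ≤ n → double m ≤ double n
double-mono-≤ z≤n       = z≤n
double-mono-≤ (s≤s m≤n) = s≤s (s≤s (double-mono-≤ m≤n))

double-cancel-≤ : ∀ {m n} → double m ≤ suc (double n) → m ≤ n
double-cancel-≤ {zero}              _                 = z≤n
double-cancel-≤ {suc m} {suc n} (s≤s (s≤s 2m≤1+2n)) = s≤s (double-cancel-≤ 2m≤1+2n)

1+double-< : ∀ {m n} → m < n → suc (double m) < double n
1+double-< {zero}  {suc n} _         = s≤s (s≤s z≤n)
1+double-< {suc m} {suc n} (s≤s m<n) = s≤s (s≤s (1+double-< m<n))

∸-split : ∀ {a b c} → a ≤ b → b ≤ c → c ∸ a ≡ (c ∸ b) ℕ.+ (b ∸ a)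
∸-split {a} {b} {c} a≤b b≤c = trans (cong (_∸ a) (sym (ℕP.m∸n+n≡m b≤c))) (ℕP.+-∸-assoc (c ∸ b) a≤b)

sumTo-cong : ∀ n {f g : ℕ → ℚ} → (∀ j → j < n → f j ≡ g j) → sumTo n f ≡ sumTo n g
sumTo-cong zero    f≡g = refl
sumTo-cong (suc n) f≡g = cong₂ _+_ (sumTo-cong n (λ j j<n → f≡g j (ℕP.m<n⇒m<1+n j<n))) (f≡g n ℕP.≤-refl)

sumTo-ext : ∀ n {f g : ℕ → ℚ} → (∀ j → f j ≡ g j) → sumTo n f ≡ sumTo n g
sumTo-ext n f≡g = sumTo-cong n (λ j _ → f≡g j)

sumTo-+ : ∀ n (f g : ℕ → ℚ) → sumTo n (λ j → f j + g j) ≡ sumTo n f + sumTo n g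
sumTo-+ zero    f g = refl
sumTo-+ (suc n) f g = trans (cong (_+ (f n + g n)) (sumTo-+ n f g))
  (solve 4 (λ a b c d → (a :+ b) :+ (c :+ d) := (a :+ c) :+ (b :+ d)) refl (sumTo n f) (sumTo n g) (f n) (g n))

*-distribˡ-sumTo : ∀ n c (f : ℕ → ℚ) → c * sumTo n f ≡ sumTo n (λ j → c * f j)
*-distribˡ-sumTo zero    c f = ℚP.*-zeroʳ c
*-distribˡ-sumTo (suc n) c f = trans (ℚP.*-distribˡ-+ c (sumTo n f) (f n)) (cong (_+ (c * f n)) (*-distribˡ-sumTo n c f))

neg-distrib-sumTo : ∀ n (f : ℕ → ℚ) → - sumTo n f ≡ sumTo n (λ j → - f j)
neg-distrib-sumTo zero    f = refl
neg-distrib-sumTo (suc n) f = trans (ℚP.neg-distrib-+ (sumTo n f) (f n)) (cong (_+ (- f n)) (neg-distrib-sumTo n f))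

sumTo-zero : ∀ n (f : ℕ → ℚ) → (∀ j → j < n → f j ≡ 0ℚ) → sumTo n f ≡ 0ℚ
sumTo-zero n f f≡0 = trans (sumTo-cong n f≡0) (sumTo-const0 n)
  where
  sumTo-const0 : ∀ n → sumTo n (λ _ → 0ℚ) ≡ 0ℚ
  sumTo-const0 zero    = refl
  sumTo-const0 (suc n) = cong (_+ 0ℚ) (sumTo-const0 n)

sumTo-++ : ∀ m n (f : ℕ → ℚ) → sumTo (m ℕ.+ n) f ≡ sumTo m f + sumTo n (λ j → f (m ℕ.+ j))
sumTo-++ m zero f rewrite ℕP.+-identityʳ m = sym (ℚP.+-identityʳ _)
sumTo-++ m (suc n) f rewrite ℕP.+-suc m n =
  trans (cong (_+ f (m ℕ.+ n)) (sumTo-++ m n f)) (ℚP.+-assoc (sumTo m f) _ _)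

sumTo-sucˡ : ∀ n (f : ℕ → ℚ) → sumTo (suc n) f ≡ f 0 + sumTo n (λ j → f (suc j))
sumTo-sucˡ n f = trans (sumTo-++ 1 n f) (cong (_+ sumTo n (λ j → f (suc j))) (ℚP.+-identityˡ (f 0)))

sumTo-swap : ∀ m n (f : ℕ → ℕ → ℚ) →
  sumTo m (λ a → sumTo n (f a)) ≡ sumTo n (λ b → sumTo m (λ a → f a b))
sumTo-swap zero    n f = sym (sumTo-zero n _ (λ _ _ → refl))
sumTo-swap (suc m) n f = trans (cong (_+ sumTo n (f m)) (sumTo-swap m n f))
                               (sym (sumTo-+ n (λ b → sumTo m (λ a → f a b)) (f m)))

sumTo-reverse : ∀ n (f : ℕ → ℚ) → sumTo n f ≡ sumTo n (λ j → f (n ∸ suc j))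
sumTo-reverse zero    f = refl
sumTo-reverse (suc n) f = trans (cong (_+ f n) (sumTo-reverse n f))
  (trans (ℚP.+-comm _ (f n)) (sym (sumTo-sucˡ n (λ j → f (n ∸ j)))))

sumTo-single : ∀ n (f : ℕ → ℚ) k → k < n → (∀ j → j < n → ¬ j ≡ k → f j ≡ 0ℚ) → sumTo n f ≡ f k
sumTo-single (suc n) f k k<1+n f≡0 with ℕP.m≤n⇒m<n∨m≡n (ℕP.≤-pred k<1+n)
... | inj₁ k<n  = trans (cong₂ _+_ (sumTo-single n f k k<n (λ j j<n → f≡0 j (ℕP.m<n⇒m<1+n j<n)))
                                   (f≡0 n ℕP.≤-refl (λ n≡k → ℕP.<-irrefl (sym n≡k) k<n)))
                        (ℚP.+-identityʳ (f k))
... | inj₂ refl = trans (cong (_+ f k) (sumTo-zero n f (λ j j<n → f≡0 j (ℕP.m<n⇒m<1+n j<n) (λ j≡n → ℕP.<-irrefl j≡n j<n))))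
                        (ℚP.+-identityˡ (f k))

sumTo-extend : ∀ {m n} (f : ℕ → ℚ) → m ≤ n → (∀ j → m ≤ j → j < n → f j ≡ 0ℚ) → sumTo n f ≡ sumTo m f
sumTo-extend {m} {n} f m≤n f≡0 = begin
  sumTo n f                                            ≡⟨ cong (λ t → sumTo t f) (ℕP.m+[n∸m]≡n m≤n) ⟨
  sumTo (m ℕ.+ (n ∸ m)) f                              ≡⟨ sumTo-++ m (n ∸ m) f ⟩
  sumTo m f + sumTo (n ∸ m) (λ j → f (m ℕ.+ j))        ≡⟨ cong (λ s → sumTo m f + s) (sumTo-zero (n ∸ m) _ tail≡0) ⟩
  sumTo m f + 0ℚ                                       ≡⟨ ℚP.+-identityʳ (sumTo m f) ⟩
  sumTo m f                                            ∎
  where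
  open ≡-Reasoning
  tail≡0 : ∀ j → j < n ∸ m → f (m ℕ.+ j) ≡ 0ℚ
  tail≡0 j j<n∸m = f≡0 (m ℕ.+ j) (ℕP.m≤m+n m j)
    (subst (m ℕ.+ j <_) (ℕP.m+[n∸m]≡n m≤n) (ℕP.+-monoʳ-< m j<n∸m))

sumTo-pairs : ∀ n (f : ℕ → ℚ) → sumTo (double n) f ≡ sumTo n (λ t → f (double t) + f (suc (double t)))
sumTo-pairs zero    f = refl
sumTo-pairs (suc n) f = trans (ℚP.+-assoc (sumTo (double n) f) (f (double n)) (f (suc (double n))))
                              (cong (_+ (f (double n) + f (suc (double n)))) (sumTo-pairs n f))

-- Binomial coefficients and powers

C-factorial : ∀ {n k} → k ≤ n → (n C k) ℕ.* (k ! ℕ.* (n ∸ k) !) ≡ n !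
C-factorial {n} {k} k≤n = trans (cong (ℕ._* (k ! ℕ.* (n ∸ k) !)) (nCk≡n!/k![n-k]! k≤n))
                                (m/n*n≡m {{k ℕP.!* (n ∸ k) !≢0}} (k![n∸k]!∣n! k≤n))

C-subset : ∀ {n b c} → b ℕ.+ c ≤ n → (n C (b ℕ.+ c)) ℕ.* ((b ℕ.+ c) C b) ≡ (n C b) ℕ.* ((n ∸ b) C c)
C-subset {n} {b} {c} b+c≤n =
  ℕP.*-cancelʳ-≡ _ _ (b ! ℕ.* (c ! ℕ.* r !)) {{ℕP.m*n≢0 _ _ {{b ℕP.!≢0}} {{c ℕP.!* r !≢0}}}}
    (trans lhs (sym rhs))
  where
  r = n ∸ (b ℕ.+ c)
  b≤b+c = ℕP.m≤m+n b c
  b≤n = ℕP.≤-trans b≤b+c b+c≤n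
  c≤n∸b : c ≤ n ∸ b
  c≤n∸b = subst (_≤ n ∸ b) (ℕP.m+n∸m≡n b c) (ℕP.∸-monoˡ-≤ b b+c≤n)
  lhs : (n C (b ℕ.+ c)) ℕ.* ((b ℕ.+ c) C b) ℕ.* (b ! ℕ.* (c ! ℕ.* r !)) ≡ n !
  lhs = begin
    (n C (b ℕ.+ c)) ℕ.* ((b ℕ.+ c) C b) ℕ.* (b ! ℕ.* (c ! ℕ.* r !))
      ≡⟨ regroup (n C (b ℕ.+ c)) ((b ℕ.+ c) C b) (b !) (c !) (r !) ⟩
    (n C (b ℕ.+ c)) ℕ.* (((b ℕ.+ c) C b) ℕ.* (b ! ℕ.* c !) ℕ.* r !)
      ≡⟨ cong (λ t → (n C (b ℕ.+ c)) ℕ.* (((b ℕ.+ c) C b) ℕ.* (b ! ℕ.* t !) ℕ.* r !)) (ℕP.m+n∸m≡n b c) ⟨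
    (n C (b ℕ.+ c)) ℕ.* (((b ℕ.+ c) C b) ℕ.* (b ! ℕ.* ((b ℕ.+ c) ∸ b) !) ℕ.* r !)
      ≡⟨ cong (λ t → (n C (b ℕ.+ c)) ℕ.* (t ℕ.* r !)) (C-factorial b≤b+c) ⟩
    (n C (b ℕ.+ c)) ℕ.* ((b ℕ.+ c) ! ℕ.* r !)
      ≡⟨ C-factorial b+c≤n ⟩
    n ! ∎
    where
    open ≡-Reasoning
    regroup : ∀ x y u v w → x ℕ.* y ℕ.* (u ℕ.* (v ℕ.* w)) ≡ x ℕ.* (y ℕ.* (u ℕ.* v) ℕ.* w)
    regroup = solve-∀
  rhs : (n C b) ℕ.* ((n ∸ b) C c) ℕ.* (b ! ℕ.* (c ! ℕ.* r !)) ≡ n !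
  rhs = begin
    (n C b) ℕ.* ((n ∸ b) C c) ℕ.* (b ! ℕ.* (c ! ℕ.* r !))
      ≡⟨ regroup (n C b) ((n ∸ b) C c) (b !) (c !) (r !) ⟩
    (n C b) ℕ.* (b ! ℕ.* (((n ∸ b) C c) ℕ.* (c ! ℕ.* r !)))
      ≡⟨ cong (λ t → (n C b) ℕ.* (b ! ℕ.* (((n ∸ b) C c) ℕ.* (c ! ℕ.* t !)))) (ℕP.∸-+-assoc n b c) ⟨
    (n C b) ℕ.* (b ! ℕ.* (((n ∸ b) C c) ℕ.* (c ! ℕ.* ((n ∸ b) ∸ c) !)))
      ≡⟨ cong (λ t → (n C b) ℕ.* (b ! ℕ.* t)) (C-factorial c≤n∸b) ⟩
    (n C b) ℕ.* (b ! ℕ.* (n ∸ b) !)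
      ≡⟨ C-factorial b≤n ⟩
    n ! ∎
    where
    open ≡-Reasoning
    regroup : ∀ x y u v w → x ℕ.* y ℕ.* (u ℕ.* (v ℕ.* w)) ≡ x ℕ.* (u ℕ.* (y ℕ.* (v ℕ.* w)))
    regroup = solve-∀

C-absorption : ∀ m n → suc m ℕ.* (suc n C suc m) ≡ suc n ℕ.* (n C m)
C-absorption m n with ℕP.≤-<-connex m n
... | inj₂ n<m rewrite k>n⇒nCk≡0 (s≤s n<m) | k>n⇒nCk≡0 n<m = trans (ℕP.*-zeroʳ (suc m)) (sym (ℕP.*-zeroʳ (suc n)))
... | inj₁ m≤n = ℕP.*-cancelʳ-≡ _ _ (m ! ℕ.* (n ∸ m) !) {{m ℕP.!* (n ∸ m) !≢0}} (begin
  suc m ℕ.* (suc n C suc m) ℕ.* (m ! ℕ.* (n ∸ m) !)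
    ≡⟨ regroup (suc m) (suc n C suc m) (m !) ((n ∸ m) !) ⟩
  (suc n C suc m) ℕ.* (suc m ! ℕ.* (suc n ∸ suc m) !)
    ≡⟨ C-factorial (s≤s m≤n) ⟩
  suc n ℕ.* n !
    ≡⟨ cong (suc n ℕ.*_) (C-factorial m≤n) ⟨
  suc n ℕ.* ((n C m) ℕ.* (m ! ℕ.* (n ∸ m) !))
    ≡⟨ ℕP.*-assoc (suc n) (n C m) _ ⟨
  suc n ℕ.* (n C m) ℕ.* (m ! ℕ.* (n ∸ m) !) ∎)
  where
  open ≡-Reasoning
  regroup : ∀ s x u v → s ℕ.* x ℕ.* (u ℕ.* v) ≡ x ℕ.* (s ℕ.* u ℕ.* v)
  regroup = solve-∀

[1+n]Cn≡1+n : ∀ n → suc n C n ≡ suc n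
[1+n]Cn≡1+n n = trans (nCk≡nC[n∸k] (ℕP.n≤1+n n)) (trans (cong (suc n C_) (ℕP.m+n∸n≡m 1 n)) (nC1≡n (suc n)))

C-absorption-ℚ : ∀ m n → ℕtoℚ (suc n C suc m) ≡ 1/ℕ (suc m) * (ℕtoℚ (suc n) * ℕtoℚ (n C m))
C-absorption-ℚ m n = begin
  ℕtoℚ (suc n C suc m)                                  ≡⟨ 1/ℕ-cancelˡ m (ℕtoℚ (suc n C suc m)) ⟨
  1/ℕ (suc m) * (ℕtoℚ (suc m) * ℕtoℚ (suc n C suc m))   ≡⟨ cong (1/ℕ (suc m) *_) (ℕtoℚ-* (suc m) (suc n C suc m)) ⟨
  1/ℕ (suc m) * ℕtoℚ (suc m ℕ.* (suc n C suc m))        ≡⟨ cong (λ c → 1/ℕ (suc m) * ℕtoℚ c) (C-absorption m n) ⟩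
  1/ℕ (suc m) * ℕtoℚ (suc n ℕ.* (n C m))                ≡⟨ cong (1/ℕ (suc m) *_) (ℕtoℚ-* (suc n) (n C m)) ⟩
  1/ℕ (suc m) * (ℕtoℚ (suc n) * ℕtoℚ (n C m))           ∎
  where open ≡-Reasoning

pow-+ : ∀ x a b → pow x (a ℕ.+ b) ≡ pow x a * pow x b
pow-+ x zero    b = sym (ℚP.*-identityˡ _)
pow-+ x (suc a) b = trans (cong (x *_) (pow-+ x a b)) (sym (ℚP.*-assoc x _ _))

pow-* : ∀ x y n → pow (x * y) n ≡ pow x n * pow y n
pow-* x y zero    = refl
pow-* x y (suc n) = trans (cong ((x * y) *_) (pow-* x y n))
  (solve 4 (λ x y a b → (x :* y) :* (a :* b) := (x :* a) :* (y :* b)) refl x y (pow x n) (pow y n))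

pow-1ℚ : ∀ n → pow 1ℚ n ≡ 1ℚ
pow-1ℚ zero    = refl
pow-1ℚ (suc n) = trans (ℚP.*-identityˡ _) (pow-1ℚ n)

pow-neg : ∀ x n → pow (- x) n ≡ sgn n * pow x n
pow-neg x n = trans (cong (λ t → pow t n) (solve 1 (λ x → :- x := (:- con 1ℚ) :* x) refl x)) (pow-* (- 1ℚ) x n)

sgn-+ : ∀ a b → sgn (a ℕ.+ b) ≡ sgn a * sgn b
sgn-+ = pow-+ (- 1ℚ)

sgn-double : ∀ n → sgn (double n) ≡ 1ℚ
sgn-double zero    = refl
sgn-double (suc n) = cong (λ t → - 1ℚ * (- 1ℚ * t)) (sgn-double n)

sgn-odd : ∀ n → sgn (suc (double n)) ≡ - 1ℚ
sgn-odd n = cong (- 1ℚ *_) (sgn-double n)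

sgn-square : ∀ n → sgn n * sgn n ≡ 1ℚ
sgn-square n = trans (sym (sgn-+ n n)) (trans (cong sgn (n+n≡double n)) (sgn-double n))

binomialTerm : ℕ → ℚ → ℚ → ℕ → ℚ
binomialTerm n x y a = ℕtoℚ (n C a) * pow x a * pow y (n ∸ a)

binomial : ∀ n x y → pow (x + y) n ≡ sumTo (suc n) (binomialTerm n x y)
binomial zero    x y = refl
binomial (suc n) x y = sym (begin
  sumTo (suc (suc n)) (binomialTerm (suc n) x y)
    ≡⟨ sumTo-sucˡ (suc n) _ ⟩
  g 0 + sumTo (suc n) (λ b → binomialTerm (suc n) x y (suc b))
    ≡⟨ cong (λ s → g 0 + s) (trans (sumTo-ext (suc n) pascal) (sumTo-+ (suc n) _ _)) ⟩
  g 0 + (sumTo (suc n) (λ b → x * t b) + sumTo (suc n) (λ b → g (suc b)))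
    ≡⟨ solve 3 (λ a s r → a :+ (s :+ r) := s :+ (a :+ r)) refl
               (g 0) (sumTo (suc n) (λ b → x * t b)) (sumTo (suc n) (λ b → g (suc b))) ⟩
  sumTo (suc n) (λ b → x * t b) + (g 0 + sumTo (suc n) (λ b → g (suc b)))
    ≡⟨ cong₂ _+_ (sym (*-distribˡ-sumTo (suc n) x t)) (sym (sumTo-sucˡ (suc n) g)) ⟩
  x * sumTo (suc n) t + sumTo (suc (suc n)) g
    ≡⟨ cong (λ s → x * sumTo (suc n) t + s) shifted ⟩
  x * sumTo (suc n) t + y * sumTo (suc n) t
    ≡⟨ ℚP.*-distribʳ-+ (sumTo (suc n) t) x y ⟨
  (x + y) * sumTo (suc n) t
    ≡⟨ cong ((x + y) *_) (binomial n x y) ⟨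
  pow (x + y) (suc n) ∎)
  where
  open ≡-Reasoning
  t = binomialTerm n x y
  g : ℕ → ℚ
  g a = ℕtoℚ (n C a) * pow x a * pow y (suc n ∸ a)
  pascal : ∀ b → binomialTerm (suc n) x y (suc b) ≡ x * t b + g (suc b)
  pascal b = trans (cong (λ c → c * pow x (suc b) * pow y (n ∸ b))
                     (trans (cong ℕtoℚ (sym (nCk+nC[k+1]≡[n+1]C[k+1] n b))) (ℕtoℚ-+ (n C b) (n C suc b))))
    (solve 5 (λ c₁ c₂ x p q → (c₁ :+ c₂) :* (x :* p) :* q := x :* (c₁ :* p :* q) :+ c₂ :* (x :* p) :* q) refl
       (ℕtoℚ (n C b)) (ℕtoℚ (n C suc b)) x (pow x b) (pow y (n ∸ b)))
  shifted : sumTo (suc (suc n)) g ≡ y * sumTo (suc n) t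
  shifted = begin
    sumTo (suc n) g + g (suc n)
      ≡⟨ cong (λ c → sumTo (suc n) g + ℕtoℚ c * pow x (suc n) * pow y (n ∸ n)) (k>n⇒nCk≡0 (ℕP.n<1+n n)) ⟩
    sumTo (suc n) g + 0ℚ * pow x (suc n) * pow y (n ∸ n)
      ≡⟨ solve 3 (λ s p q → s :+ con 0ℚ :* p :* q := s) refl (sumTo (suc n) g) (pow x (suc n)) (pow y (n ∸ n)) ⟩
    sumTo (suc n) g
      ≡⟨ sumTo-cong (suc n) (λ a a<1+n → y-out a (ℕP.≤-pred a<1+n)) ⟩
    sumTo (suc n) (λ a → y * t a)
      ≡⟨ *-distribˡ-sumTo (suc n) y t ⟨
    y * sumTo (suc n) t ∎
    where
    y-out : ∀ a → a ≤ n → g a ≡ y * t a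
    y-out a a≤n = trans (cong (λ e → ℕtoℚ (n C a) * pow x a * pow y e) (ℕP.+-∸-assoc 1 a≤n))
      (solve 4 (λ c p y q → c :* p :* (y :* q) := y :* (c :* p :* q)) refl (ℕtoℚ (n C a)) (pow x a) y (pow y (n ∸ a)))

binomial-alternating : ∀ i d a b → i ≤ d →
  sumTo (suc d) (λ u → ℕtoℚ (i C u) * sgn u * pow (a + b) u * pow a (d ∸ u)) ≡ sgn i * pow a (d ∸ i) * pow b i
binomial-alternating i d a b i≤d = begin
  sumTo (suc d) f
    ≡⟨ sumTo-extend f (s≤s i≤d) (λ u i<u _ → vanish u i<u) ⟩
  sumTo (suc i) f
    ≡⟨ sumTo-cong (suc i) (λ u u<1+i → factor u (ℕP.≤-pred u<1+i)) ⟩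
  sumTo (suc i) (λ u → pow a (d ∸ i) * binomialTerm i (- (a + b)) a u)
    ≡⟨ *-distribˡ-sumTo (suc i) (pow a (d ∸ i)) (binomialTerm i (- (a + b)) a) ⟨
  pow a (d ∸ i) * sumTo (suc i) (binomialTerm i (- (a + b)) a)
    ≡⟨ cong (pow a (d ∸ i) *_) (binomial i (- (a + b)) a) ⟨
  pow a (d ∸ i) * pow (- (a + b) + a) i
    ≡⟨ cong (λ t → pow a (d ∸ i) * pow t i) (solve 2 (λ a b → :- (a :+ b) :+ a := :- b) refl a b) ⟩
  pow a (d ∸ i) * pow (- b) i
    ≡⟨ cong (pow a (d ∸ i) *_) (pow-neg b i) ⟩
  pow a (d ∸ i) * (sgn i * pow b i)
    ≡⟨ solve 3 (λ p s r → p :* (s :* r) := s :* p :* r) refl (pow a (d ∸ i)) (sgn i) (pow b i) ⟩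
  sgn i * pow a (d ∸ i) * pow b i ∎
  where
  open ≡-Reasoning
  f = λ u → ℕtoℚ (i C u) * sgn u * pow (a + b) u * pow a (d ∸ u)
  vanish : ∀ u → i < u → f u ≡ 0ℚ
  vanish u i<u = trans (cong (λ c → ℕtoℚ c * sgn u * pow (a + b) u * pow a (d ∸ u)) (k>n⇒nCk≡0 i<u))
    (solve 3 (λ s p r → con 0ℚ :* s :* p :* r := con 0ℚ) refl (sgn u) (pow (a + b) u) (pow a (d ∸ u)))
  factor : ∀ u → u ≤ i → f u ≡ pow a (d ∸ i) * binomialTerm i (- (a + b)) a u
  factor u u≤i = begin
    ℕtoℚ (i C u) * sgn u * pow (a + b) u * pow a (d ∸ u)
      ≡⟨ cong (λ e → ℕtoℚ (i C u) * sgn u * pow (a + b) u * pow a e) (∸-split u≤i i≤d) ⟩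
    ℕtoℚ (i C u) * sgn u * pow (a + b) u * pow a ((d ∸ i) ℕ.+ (i ∸ u))
      ≡⟨ cong (ℕtoℚ (i C u) * sgn u * pow (a + b) u *_) (pow-+ a (d ∸ i) (i ∸ u)) ⟩
    ℕtoℚ (i C u) * sgn u * pow (a + b) u * (pow a (d ∸ i) * pow a (i ∸ u))
      ≡⟨ solve 5 (λ c s p r t → c :* s :* p :* (r :* t) := r :* (c :* (s :* p) :* t)) refl
               (ℕtoℚ (i C u)) (sgn u) (pow (a + b) u) (pow a (d ∸ i)) (pow a (i ∸ u)) ⟩
    pow a (d ∸ i) * (ℕtoℚ (i C u) * (sgn u * pow (a + b) u) * pow a (i ∸ u))
      ≡⟨ cong (λ t → pow a (d ∸ i) * (ℕtoℚ (i C u) * t * pow a (i ∸ u))) (pow-neg (a + b) u) ⟨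
    pow a (d ∸ i) * binomialTerm i (- (a + b)) a u ∎

-- Bernoulli numbers and homogenised Bernoulli polynomials

δ₁ : ℕ → ℚ
δ₁ 1 = 1ℚ
δ₁ _ = 0ℚ

if-T : ∀ {A : Set} b {x y : A} → T b → (if b then x else y) ≡ x
if-T true _ = refl

if-¬T : ∀ {A : Set} b {x y : A} → ¬ T b → (if b then x else y) ≡ y
if-¬T true  ¬b = ⊥-elim (¬b _)
if-¬T false _  = refl

bernUpTo-suc : ∀ {j m} → j ≤ m → bernUpTo (suc m) j ≡ bernUpTo m j
bernUpTo-suc {j} {m} j≤m = if-T (j ≤ᵇ m) (ℕP.≤⇒≤ᵇ j≤m)

bernUpTo-stable : ∀ j m → j ≤ m → bernUpTo m j ≡ B j
bernUpTo-stable j zero    z≤n   = refl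
bernUpTo-stable j (suc m) j≤1+m = [ below , top ]′ (ℕP.m≤n⇒m<n∨m≡n j≤1+m)
  where
  below : j < suc m → bernUpTo (suc m) j ≡ B j
  below j<1+m = trans (bernUpTo-suc (ℕP.≤-pred j<1+m)) (bernUpTo-stable j m (ℕP.≤-pred j<1+m))
  top : j ≡ suc m → bernUpTo (suc m) j ≡ B j
  top j≡1+m = cong (λ n → bernUpTo n j) (sym j≡1+m)

B-suc : ∀ m → B (suc m) ≡ (- 1/ℕ (suc (suc m))) * sumTo (suc m) (λ l → ℕtoℚ (suc (suc m) C l) * B l)
B-suc m = trans (if-¬T (suc m ≤ᵇ m) (λ 1+m≤m → ℕP.<-irrefl refl (ℕP.≤ᵇ⇒≤ (suc m) m 1+m≤m)))
  (cong ((- 1/ℕ (suc (suc m))) *_)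
    (sumTo-cong (suc m) (λ l l<1+m → cong (ℕtoℚ (suc (suc m) C l) *_) (bernUpTo-stable l m (ℕP.≤-pred l<1+m)))))

B-recurrence : ∀ p → sumTo p (λ l → ℕtoℚ (p C l) * B l) ≡ δ₁ p
B-recurrence zero          = refl
B-recurrence (suc zero)    = refl
B-recurrence (suc (suc m)) = begin
  S + ℕtoℚ (suc (suc m) C suc m) * B (suc m)
    ≡⟨ cong (λ c → S + ℕtoℚ c * B (suc m)) ([1+n]Cn≡1+n (suc m)) ⟩
  S + n * B (suc m)
    ≡⟨ cong (λ b → S + n * b) (B-suc m) ⟩
  S + n * ((- 1/n) * S)
    ≡⟨ solve 3 (λ s n i → s :+ n :* ((:- i) :* s) := s :* (con 1ℚ :- i :* n)) refl S n 1/n ⟩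
  S * (1ℚ - 1/n * n)
    ≡⟨ cong (λ t → S * (1ℚ - t)) (1/ℕ-inverseˡ (suc m)) ⟩
  S * (1ℚ - 1ℚ)
    ≡⟨ ℚP.*-zeroʳ S ⟩
  0ℚ ∎
  where
  open ≡-Reasoning
  S = sumTo (suc m) (λ l → ℕtoℚ (suc (suc m) C l) * B l)
  n = ℕtoℚ (suc (suc m))
  1/n = 1/ℕ (suc (suc m))

𝔹-term : ℕ → ℚ → ℚ → ℕ → ℚ
𝔹-term N X Y a = ℕtoℚ (N C a) * B (N ∸ a) * pow X (N ∸ a) * pow Y a

𝔹 : ℕ → ℚ → ℚ → ℚ
𝔹 N X Y = sumTo (suc N) (𝔹-term N X Y)

private
  𝔹-expansion : ℕ → ℚ → ℚ → ℚ → ℕ → ℕ → ℚ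
  𝔹-expansion N X Y Z a b = ℕtoℚ (N C a) * B (N ∸ a) * pow X (N ∸ a) * binomialTerm a Y Z b

  𝔹-expansion-high : ∀ N X Y Z {a b} → a < b → 𝔹-expansion N X Y Z a b ≡ 0ℚ
  𝔹-expansion-high N X Y Z {a} {b} a<b rewrite k>n⇒nCk≡0 a<b =
    solve 5 (λ c d e f g → c :* d :* e :* (con 0ℚ :* f :* g) := con 0ℚ) refl
      (ℕtoℚ (N C a)) (B (N ∸ a)) (pow X (N ∸ a)) (pow Y b) (pow Z (a ∸ b))

  𝔹-expansion-reindex : ∀ N X Y Z b c → b ℕ.+ c ≤ N →
    𝔹-expansion N X Y Z (b ℕ.+ c) b ≡ ℕtoℚ (N C b) * pow Y b * 𝔹-term (N ∸ b) X Z c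
  𝔹-expansion-reindex N X Y Z b c b+c≤N = begin
    ℕtoℚ (N C (b ℕ.+ c)) * B (N ∸ (b ℕ.+ c)) * pow X (N ∸ (b ℕ.+ c)) * (ℕtoℚ ((b ℕ.+ c) C b) * pow Y b * pow Z ((b ℕ.+ c) ∸ b))
      ≡⟨ cong₂ (λ u v → ℕtoℚ (N C (b ℕ.+ c)) * B u * pow X u * (ℕtoℚ ((b ℕ.+ c) C b) * pow Y b * pow Z v))
               (sym (ℕP.∸-+-assoc N b c)) (ℕP.m+n∸m≡n b c) ⟩
    ℕtoℚ (N C (b ℕ.+ c)) * B M * pow X M * (ℕtoℚ ((b ℕ.+ c) C b) * pow Y b * pow Z c)
      ≡⟨ solve 6 (λ c₁ c₂ β ξ η ζ → c₁ :* β :* ξ :* (c₂ :* η :* ζ) := (c₁ :* c₂) :* η :* (β :* ξ :* ζ)) refl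
               (ℕtoℚ (N C (b ℕ.+ c))) (ℕtoℚ ((b ℕ.+ c) C b)) (B M) (pow X M) (pow Y b) (pow Z c) ⟩
    (ℕtoℚ (N C (b ℕ.+ c)) * ℕtoℚ ((b ℕ.+ c) C b)) * pow Y b * (B M * pow X M * pow Z c)
      ≡⟨ cong (λ u → u * pow Y b * (B M * pow X M * pow Z c)) coefficients ⟩
    (ℕtoℚ (N C b) * ℕtoℚ ((N ∸ b) C c)) * pow Y b * (B M * pow X M * pow Z c)
      ≡⟨ solve 6 (λ c₁ c₂ η β ξ ζ → c₁ :* c₂ :* η :* (β :* ξ :* ζ) := c₁ :* η :* (c₂ :* β :* ξ :* ζ)) refl
               (ℕtoℚ (N C b)) (ℕtoℚ ((N ∸ b) C c)) (pow Y b) (B M) (pow X M) (pow Z c) ⟩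
    ℕtoℚ (N C b) * pow Y b * 𝔹-term (N ∸ b) X Z c ∎
    where
    open ≡-Reasoning
    M = N ∸ b ∸ c
    coefficients : ℕtoℚ (N C (b ℕ.+ c)) * ℕtoℚ ((b ℕ.+ c) C b) ≡ ℕtoℚ (N C b) * ℕtoℚ ((N ∸ b) C c)
    coefficients = trans (sym (ℕtoℚ-* (N C (b ℕ.+ c)) ((b ℕ.+ c) C b)))
                     (trans (cong ℕtoℚ (C-subset {N} {b} {c} b+c≤N)) (ℕtoℚ-* (N C b) ((N ∸ b) C c)))

  𝔹-expansion-column : ∀ N X Y Z b → b ≤ N →
    sumTo (suc N) (λ a → 𝔹-expansion N X Y Z a b) ≡ ℕtoℚ (N C b) * pow Y b * 𝔹 (N ∸ b) X Z
  𝔹-expansion-column N X Y Z b b≤N = begin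
    sumTo (suc N) t
      ≡⟨ cong (λ n → sumTo n t) (trans (ℕP.+-suc b (N ∸ b)) (cong suc (ℕP.m+[n∸m]≡n b≤N))) ⟨
    sumTo (b ℕ.+ suc (N ∸ b)) t
      ≡⟨ sumTo-++ b (suc (N ∸ b)) t ⟩
    sumTo b t + sumTo (suc (N ∸ b)) (λ c → t (b ℕ.+ c))
      ≡⟨ cong (_+ sumTo (suc (N ∸ b)) (λ c → t (b ℕ.+ c))) (sumTo-zero b t (λ a a<b → 𝔹-expansion-high N X Y Z a<b)) ⟩
    0ℚ + sumTo (suc (N ∸ b)) (λ c → t (b ℕ.+ c))
      ≡⟨ ℚP.+-identityˡ _ ⟩
    sumTo (suc (N ∸ b)) (λ c → t (b ℕ.+ c))
      ≡⟨ sumTo-cong (suc (N ∸ b)) (λ c c≤N∸b → 𝔹-expansion-reindex N X Y Z b c (b+c≤N (ℕP.≤-pred c≤N∸b))) ⟩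
    sumTo (suc (N ∸ b)) (λ c → ℕtoℚ (N C b) * pow Y b * 𝔹-term (N ∸ b) X Z c)
      ≡⟨ *-distribˡ-sumTo (suc (N ∸ b)) (ℕtoℚ (N C b) * pow Y b) (𝔹-term (N ∸ b) X Z) ⟨
    ℕtoℚ (N C b) * pow Y b * 𝔹 (N ∸ b) X Z ∎
    where
    open ≡-Reasoning
    t = λ a → 𝔹-expansion N X Y Z a b
    b+c≤N : ∀ {c} → c ≤ N ∸ b → b ℕ.+ c ≤ N
    b+c≤N {c} c≤N∸b = subst (b ℕ.+ c ≤_) (ℕP.m+[n∸m]≡n b≤N) (ℕP.+-monoʳ-≤ b c≤N∸b)

𝔹-+ : ∀ N X Y Z → 𝔹 N X (Y + Z) ≡ sumTo (suc N) (λ b → ℕtoℚ (N C b) * pow Y b * 𝔹 (N ∸ b) X Z)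
𝔹-+ N X Y Z = begin
  sumTo (suc N) (𝔹-term N X (Y + Z))
    ≡⟨ sumTo-ext (suc N) (λ a → trans (cong (c a *_) (binomial a Y Z)) (*-distribˡ-sumTo (suc a) (c a) (binomialTerm a Y Z))) ⟩
  sumTo (suc N) (λ a → sumTo (suc a) (t a))
    ≡⟨ sumTo-cong (suc N) (λ a a<1+N → sym (sumTo-extend (t a) a<1+N (λ b a<b _ → 𝔹-expansion-high N X Y Z a<b))) ⟩
  sumTo (suc N) (λ a → sumTo (suc N) (t a))
    ≡⟨ sumTo-swap (suc N) (suc N) t ⟩
  sumTo (suc N) (λ b → sumTo (suc N) (λ a → t a b))
    ≡⟨ sumTo-cong (suc N) (λ b b<1+N → 𝔹-expansion-column N X Y Z b (ℕP.≤-pred b<1+N)) ⟩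
  sumTo (suc N) (λ b → ℕtoℚ (N C b) * pow Y b * 𝔹 (N ∸ b) X Z) ∎
  where
  open ≡-Reasoning
  c = λ a → ℕtoℚ (N C a) * B (N ∸ a) * pow X (N ∸ a)
  t = 𝔹-expansion N X Y Z

-- B⁺ p = B_p(1): the Bernoulli numbers with the opposite sign convention B⁺₁ = +1/2.
B⁺ : ℕ → ℚ
B⁺ p = B p + δ₁ p

sumTo-C-reverse : ∀ N (f : ℕ → ℚ) →
  sumTo (suc N) (λ a → ℕtoℚ (N C a) * f (N ∸ a)) ≡ sumTo (suc N) (λ l → ℕtoℚ (N C l) * f l)
sumTo-C-reverse N f = trans (sumTo-reverse (suc N) (λ a → ℕtoℚ (N C a) * f (N ∸ a)))
  (sumTo-cong (suc N) (λ l l<1+N → let l≤N = ℕP.≤-pred l<1+N in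
     trans (cong (λ t → ℕtoℚ (N C (N ∸ l)) * f t) (ℕP.m∸[m∸n]≡n l≤N))
           (cong (λ c → ℕtoℚ c * f l) (sym (nCk≡nC[n∸k] l≤N)))))

𝔹-diagonal : ∀ p X → 𝔹 p X X ≡ pow X p * B⁺ p
𝔹-diagonal p X = begin
  𝔹 p X X
    ≡⟨ sumTo-cong (suc p) (λ c c<1+p → factor c (ℕP.≤-pred c<1+p)) ⟩
  sumTo (suc p) (λ c → pow X p * (ℕtoℚ (p C c) * B (p ∸ c)))
    ≡⟨ *-distribˡ-sumTo (suc p) (pow X p) _ ⟨
  pow X p * sumTo (suc p) (λ c → ℕtoℚ (p C c) * B (p ∸ c))
    ≡⟨ cong (pow X p *_) (sumTo-C-reverse p B) ⟩
  pow X p * (sumTo p (λ l → ℕtoℚ (p C l) * B l) + ℕtoℚ (p C p) * B p)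
    ≡⟨ cong₂ (λ s c → pow X p * (s + ℕtoℚ c * B p)) (B-recurrence p) (nCn≡1 p) ⟩
  pow X p * (δ₁ p + 1ℚ * B p)
    ≡⟨ cong (pow X p *_) (solve 2 (λ d b → d :+ con 1ℚ :* b := b :+ d) refl (δ₁ p) (B p)) ⟩
  pow X p * B⁺ p ∎
  where
  open ≡-Reasoning
  factor : ∀ c → c ≤ p → 𝔹-term p X X c ≡ pow X p * (ℕtoℚ (p C c) * B (p ∸ c))
  factor c c≤p = trans
    (solve 4 (λ a b u v → a :* b :* u :* v := (u :* v) :* (a :* b)) refl (ℕtoℚ (p C c)) (B (p ∸ c)) (pow X (p ∸ c)) (pow X c))
    (cong (_* (ℕtoℚ (p C c) * B (p ∸ c))) (trans (sym (pow-+ X (p ∸ c) c)) (cong (pow X) (ℕP.m∸n+n≡m c≤p))))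

private
  δ₁-∸ : ∀ M b → ¬ b ≡ M → δ₁ (suc M ∸ b) ≡ 0ℚ
  δ₁-∸ zero    zero    b≢M = ⊥-elim (b≢M refl)
  δ₁-∸ (suc M) zero    b≢M = refl
  δ₁-∸ zero    (suc b) b≢M = cong δ₁ (ℕP.0∸n≡0 b)
  δ₁-∸ (suc M) (suc b) b≢M = δ₁-∸ M b (λ b≡M → b≢M (cong suc b≡M))

  δ₁-binomialSum : ∀ N X Y →
    sumTo (suc N) (λ b → ℕtoℚ (N C b) * pow Y b * pow X (N ∸ b) * δ₁ (N ∸ b)) ≡ ℕtoℚ N * X * pow Y (N ∸ 1)
  δ₁-binomialSum zero    X Y = solve 2 (λ y x → con 0ℚ :+ con 1ℚ :* con 1ℚ :* con 1ℚ :* con 0ℚ := con 0ℚ :* x :* con 1ℚ) refl Y X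
  δ₁-binomialSum (suc M) X Y = trans
    (sumTo-single (suc (suc M)) _ M (ℕP.m≤n⇒m≤1+n ℕP.≤-refl)
      (λ b _ b≢M → trans (cong (ℕtoℚ (suc M C b) * pow Y b * pow X (suc M ∸ b) *_) (δ₁-∸ M b b≢M))
                         (ℚP.*-zeroʳ (ℕtoℚ (suc M C b) * pow Y b * pow X (suc M ∸ b)))))
    (trans (cong₂ (λ c e → ℕtoℚ c * pow Y M * pow X e * δ₁ e) ([1+n]Cn≡1+n M) (ℕP.m+n∸n≡m 1 M))
      (solve 3 (λ c y x → c :* y :* (x :* con 1ℚ) :* con 1ℚ := c :* x :* y) refl (ℕtoℚ (suc M)) (pow Y M) X))

𝔹-difference : ∀ N X Y → 𝔹 N X (Y + X) ≡ 𝔹 N X Y + ℕtoℚ N * X * pow Y (N ∸ 1)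
𝔹-difference N X Y = begin
  𝔹 N X (Y + X)
    ≡⟨ 𝔹-+ N X Y X ⟩
  sumTo (suc N) (λ b → ℕtoℚ (N C b) * pow Y b * 𝔹 (N ∸ b) X X)
    ≡⟨ sumTo-ext (suc N) split ⟩
  sumTo (suc N) (λ b → 𝔹-term N X Y b + ℕtoℚ (N C b) * pow Y b * pow X (N ∸ b) * δ₁ (N ∸ b))
    ≡⟨ sumTo-+ (suc N) (𝔹-term N X Y) _ ⟩
  𝔹 N X Y + sumTo (suc N) (λ b → ℕtoℚ (N C b) * pow Y b * pow X (N ∸ b) * δ₁ (N ∸ b))
    ≡⟨ cong (λ s → 𝔹 N X Y + s) (δ₁-binomialSum N X Y) ⟩
  𝔹 N X Y + ℕtoℚ N * X * pow Y (N ∸ 1) ∎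
  where
  open ≡-Reasoning
  split : ∀ b → ℕtoℚ (N C b) * pow Y b * 𝔹 (N ∸ b) X X ≡
                𝔹-term N X Y b + ℕtoℚ (N C b) * pow Y b * pow X (N ∸ b) * δ₁ (N ∸ b)
  split b = trans (cong (ℕtoℚ (N C b) * pow Y b *_) (𝔹-diagonal (N ∸ b) X))
    (solve 5 (λ c y x β d → c :* y :* (x :* (β :+ d)) := c :* β :* x :* y :+ c :* y :* x :* d) refl
       (ℕtoℚ (N C b)) (pow Y b) (pow X (N ∸ b)) (B (N ∸ b)) (δ₁ (N ∸ b)))

private
  𝔹-at-0 : ∀ N → 𝔹 N (- 1ℚ) 0ℚ ≡ sgn N * B N
  𝔹-at-0 N = trans (sumTo-single (suc N) (𝔹-term N (- 1ℚ) 0ℚ) 0 (s≤s z≤n) vanish)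
    (solve 2 (λ b s → con 1ℚ :* b :* s :* con 1ℚ := s :* b) refl (B N) (sgn N))
    where
    vanish : ∀ j → j < suc N → ¬ j ≡ 0 → 𝔹-term N (- 1ℚ) 0ℚ j ≡ 0ℚ
    vanish zero    _ j≢0 = ⊥-elim (j≢0 refl)
    vanish (suc j) _ _   = trans (cong (c *_) (ℚP.*-zeroˡ (pow 0ℚ j))) (ℚP.*-zeroʳ c)
      where c = ℕtoℚ (N C suc j) * B (N ∸ suc j) * pow (- 1ℚ) (N ∸ suc j)

  signedB-sum : ∀ N → sumTo N (λ l → ℕtoℚ (N C l) * (sgn l * B l)) ≡ ℕtoℚ N
  signedB-sum N = ∙-cancelʳ (ℕtoℚ (N C N) * (sgn N * B N)) S (ℕtoℚ N) (begin
    S + ℕtoℚ (N C N) * (sgn N * B N)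
      ≡⟨ sumTo-C-reverse N (λ l → sgn l * B l) ⟨
    sumTo (suc N) (λ a → ℕtoℚ (N C a) * (sgn (N ∸ a) * B (N ∸ a)))
      ≡⟨ sumTo-ext (suc N) (λ a → trans
           (solve 3 (λ c s b → c :* (s :* b) := c :* b :* s :* con 1ℚ) refl (ℕtoℚ (N C a)) (sgn (N ∸ a)) (B (N ∸ a)))
           (cong (ℕtoℚ (N C a) * B (N ∸ a) * sgn (N ∸ a) *_) (sym (pow-1ℚ a)))) ⟩
    𝔹 N (- 1ℚ) 1ℚ
      ≡⟨ solve 2 (λ p n → p := (p :+ n :* (:- con 1ℚ) :* con 1ℚ) :+ n) refl (𝔹 N (- 1ℚ) 1ℚ) (ℕtoℚ N) ⟩
    (𝔹 N (- 1ℚ) 1ℚ + ℕtoℚ N * (- 1ℚ) * 1ℚ) + ℕtoℚ N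
      ≡⟨ cong (λ t → (𝔹 N (- 1ℚ) 1ℚ + ℕtoℚ N * (- 1ℚ) * t) + ℕtoℚ N) (pow-1ℚ (N ∸ 1)) ⟨
    (𝔹 N (- 1ℚ) 1ℚ + ℕtoℚ N * (- 1ℚ) * pow 1ℚ (N ∸ 1)) + ℕtoℚ N
      ≡⟨ cong (_+ ℕtoℚ N) (𝔹-difference N (- 1ℚ) 1ℚ) ⟨
    𝔹 N (- 1ℚ) 0ℚ + ℕtoℚ N
      ≡⟨ cong (_+ ℕtoℚ N) (𝔹-at-0 N) ⟩
    sgn N * B N + ℕtoℚ N
      ≡⟨ solve 2 (λ b n → b :+ n := n :+ con 1ℚ :* b) refl (sgn N * B N) (ℕtoℚ N) ⟩
    ℕtoℚ N + 1ℚ * (sgn N * B N)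
      ≡⟨ cong (λ c → ℕtoℚ N + ℕtoℚ c * (sgn N * B N)) (nCn≡1 N) ⟨
    ℕtoℚ N + ℕtoℚ (N C N) * (sgn N * B N) ∎)
    where
    open ≡-Reasoning
    S = sumTo N (λ l → ℕtoℚ (N C l) * (sgn l * B l))

  δ₁-sum : ∀ N → sumTo N (λ l → ℕtoℚ (N C l) * δ₁ l) ≡ ℕtoℚ N - δ₁ N
  δ₁-sum zero          = refl
  δ₁-sum (suc zero)    = refl
  δ₁-sum (suc (suc M)) = trans (sumTo-single (suc (suc M)) _ 1 (s≤s (s≤s z≤n)) vanish)
    (trans (cong (λ c → ℕtoℚ c * 1ℚ) (nC1≡n (suc (suc M))))
           (solve 1 (λ n → n :* con 1ℚ := n :- con 0ℚ) refl (ℕtoℚ (suc (suc M)))))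
    where
    vanish : ∀ j → j < suc (suc M) → ¬ j ≡ 1 → ℕtoℚ (suc (suc M) C j) * δ₁ j ≡ 0ℚ
    vanish zero          _ _   = ℚP.*-zeroʳ (ℕtoℚ (suc (suc M) C 0))
    vanish (suc zero)    _ j≢1 = ⊥-elim (j≢1 refl)
    vanish (suc (suc j)) _ _   = ℚP.*-zeroʳ (ℕtoℚ (suc (suc M) C suc (suc j)))

  B⁺-sum : ∀ N → sumTo N (λ l → ℕtoℚ (N C l) * B⁺ l) ≡ ℕtoℚ N
  B⁺-sum N = begin
    sumTo N (λ l → ℕtoℚ (N C l) * B⁺ l)
      ≡⟨ sumTo-ext N (λ l → ℚP.*-distribˡ-+ (ℕtoℚ (N C l)) (B l) (δ₁ l)) ⟩
    sumTo N (λ l → ℕtoℚ (N C l) * B l + ℕtoℚ (N C l) * δ₁ l)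
      ≡⟨ sumTo-+ N _ _ ⟩
    sumTo N (λ l → ℕtoℚ (N C l) * B l) + sumTo N (λ l → ℕtoℚ (N C l) * δ₁ l)
      ≡⟨ cong₂ _+_ (B-recurrence N) (δ₁-sum N) ⟩
    δ₁ N + (ℕtoℚ N - δ₁ N)
      ≡⟨ solve 2 (λ d n → d :+ (n :- d) := n) refl (δ₁ N) (ℕtoℚ N) ⟩
    ℕtoℚ N ∎
    where open ≡-Reasoning

  -- Both (−1)^l B_l and B⁺_l solve Σ_{l<N} C(N,l) a_l = N for every N, which determines a_l.
  sgn*B≡B⁺-below : ∀ n l → l < n → sgn l * B l ≡ B⁺ l
  sgn*B≡B⁺-below (suc n) l l<1+n with ℕP.m≤n⇒m<n∨m≡n (ℕP.≤-pred l<1+n)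
  ... | inj₁ l<n  = sgn*B≡B⁺-below n l l<n
  ... | inj₂ refl = ℕtoℚ-cancelˡ l (subst (λ c → ℕtoℚ c * (sgn l * B l) ≡ ℕtoℚ c * B⁺ l) ([1+n]Cn≡1+n l)
      (∙-cancelˡ (sumTo l (λ j → ℕtoℚ (suc l C j) * (sgn j * B j))) _ _ (begin
        sumTo l (λ j → ℕtoℚ (suc l C j) * (sgn j * B j)) + ℕtoℚ (suc l C l) * (sgn l * B l)
          ≡⟨ signedB-sum (suc l) ⟩
        ℕtoℚ (suc l)
          ≡⟨ B⁺-sum (suc l) ⟨
        sumTo l (λ j → ℕtoℚ (suc l C j) * B⁺ j) + ℕtoℚ (suc l C l) * B⁺ l
          ≡⟨ cong (_+ ℕtoℚ (suc l C l) * B⁺ l) lower-terms ⟨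
        sumTo l (λ j → ℕtoℚ (suc l C j) * (sgn j * B j)) + ℕtoℚ (suc l C l) * B⁺ l ∎)))
    where
    open ≡-Reasoning
    lower-terms : sumTo l (λ j → ℕtoℚ (suc l C j) * (sgn j * B j)) ≡ sumTo l (λ j → ℕtoℚ (suc l C j) * B⁺ j)
    lower-terms = sumTo-cong l (λ j j<l → cong (ℕtoℚ (suc l C j) *_) (sgn*B≡B⁺-below l j j<l))

sgn*B≡B⁺ : ∀ l → sgn l * B l ≡ B⁺ l
sgn*B≡B⁺ l = sgn*B≡B⁺-below (suc l) l ℕP.≤-refl

B-odd : ∀ {k} → 0 < k → B (suc (double k)) ≡ 0ℚ
B-odd {suc r} _ = begin
  b                           ≡⟨ solve 1 (λ b → b := (b :- (:- con 1ℚ) :* b) :* con (1/ℕ 2)) refl b ⟩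
  (b - (- 1ℚ) * b) * 1/ℕ 2     ≡⟨ cong (λ t → (b - t) * 1/ℕ 2) -b≡b ⟩
  (b - b) * 1/ℕ 2              ≡⟨ solve 1 (λ b → (b :- b) :* con (1/ℕ 2) := con 0ℚ) refl b ⟩
  0ℚ                          ∎
  where
  open ≡-Reasoning
  b = B (suc (double (suc r)))
  -b≡b : (- 1ℚ) * b ≡ b
  -b≡b = trans (cong (_* b) (sym (sgn-odd (suc r)))) (trans (sgn*B≡B⁺ (suc (double (suc r)))) (ℚP.+-identityʳ b))

𝔹-reflection : ∀ N x y → 𝔹 N (x + y) x ≡ sgn N * 𝔹 N (x + y) y
𝔹-reflection N x y = begin
  𝔹 N X x
    ≡⟨ cong (𝔹 N X) (solve 2 (λ x y → x := (:- y) :+ (x :+ y)) refl x y) ⟩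
  𝔹 N X ((- y) + X)
    ≡⟨ 𝔹-+ N X (- y) X ⟩
  sumTo (suc N) (λ b → ℕtoℚ (N C b) * pow (- y) b * 𝔹 (N ∸ b) X X)
    ≡⟨ sumTo-cong (suc N) (λ b b<1+N → reflect b (ℕP.≤-pred b<1+N)) ⟩
  sumTo (suc N) (λ b → sgn N * 𝔹-term N X y b)
    ≡⟨ *-distribˡ-sumTo (suc N) (sgn N) (𝔹-term N X y) ⟨
  sgn N * 𝔹 N X y ∎
  where
  open ≡-Reasoning
  X = x + y
  reflect : ∀ b → b ≤ N → ℕtoℚ (N C b) * pow (- y) b * 𝔹 (N ∸ b) X X ≡ sgn N * 𝔹-term N X y b
  reflect b b≤N = begin
    ℕtoℚ (N C b) * pow (- y) b * 𝔹 (N ∸ b) X X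
      ≡⟨ cong₂ (λ u v → ℕtoℚ (N C b) * u * v) (pow-neg y b)
               (trans (𝔹-diagonal (N ∸ b) X) (cong (pow X (N ∸ b) *_) (sym (sgn*B≡B⁺ (N ∸ b))))) ⟩
    ℕtoℚ (N C b) * (sgn b * pow y b) * (pow X (N ∸ b) * (sgn (N ∸ b) * B (N ∸ b)))
      ≡⟨ solve 6 (λ c s₁ η ξ s₂ β → c :* (s₁ :* η) :* (ξ :* (s₂ :* β)) := (s₁ :* s₂) :* (c :* β :* ξ :* η)) refl
           (ℕtoℚ (N C b)) (sgn b) (pow y b) (pow X (N ∸ b)) (sgn (N ∸ b)) (B (N ∸ b)) ⟩
    (sgn b * sgn (N ∸ b)) * 𝔹-term N X y b
      ≡⟨ cong (_* 𝔹-term N X y b) (trans (sym (sgn-+ b (N ∸ b))) (cong sgn (ℕP.m+[n∸m]≡n b≤N))) ⟩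
    sgn N * 𝔹-term N X y b ∎

-- The odd Bernoulli sums S(J)

C*B-odd-vanish : ∀ r t → ¬ t ≡ r → ℕtoℚ (suc (double r) C double t) * B (suc (double r) ∸ double t) ≡ 0ℚ
C*B-odd-vanish r t t≢r = vanish (ℕP.<-cmp t r)
  where
  vanish : Tri (t < r) (t ≡ r) (r < t) → ℕtoℚ (suc (double r) C double t) * B (suc (double r) ∸ double t) ≡ 0ℚ
  vanish (tri< t<r _ _) = trans (cong (ℕtoℚ (suc (double r) C double t) *_)
                                  (trans (cong B (1+double-∸ (ℕP.<⇒≤ t<r))) (B-odd (ℕP.m<n⇒0<n∸m t<r))))
                               (ℚP.*-zeroʳ (ℕtoℚ (suc (double r) C double t)))
  vanish (tri≈ _ t≡r _) = ⊥-elim (t≢r t≡r)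
  vanish (tri> _ _ r<t) = trans (cong (λ c → ℕtoℚ c * B (suc (double r) ∸ double t)) (k>n⇒nCk≡0 (1+double-< r<t)))
                               (ℚP.*-zeroˡ (B (suc (double r) ∸ double t)))

powSum : ℚ → ℚ → ℕ → ℚ
powSum x y n = pow x n + pow y n

oddSumTerm : ℕ → ℕ → ℚ → ℚ → ℕ → ℚ
oddSumTerm L J x y j =
  1/ℕ (suc (double j)) * ℕtoℚ (J C double j) * B (J ∸ double j)
    * pow (x + y) (double L ∸ double j) * powSum x y (suc (double j))

oddSum : ℕ → ℕ → ℚ → ℚ → ℚ
oddSum L J x y = sumTo L (oddSumTerm L J x y)

private
  oddSumTerm-vanish : ∀ L r x y j → ¬ j ≡ r → oddSumTerm L (suc (double r)) x y j ≡ 0ℚ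
  oddSumTerm-vanish L r x y j j≢r = trans
    (solve 5 (λ f c b p w → f :* c :* b :* p :* w := f :* (c :* b) :* p :* w) refl
       (1/ℕ (suc (double j))) (ℕtoℚ (suc (double r) C double j)) (B (suc (double r) ∸ double j))
       (pow (x + y) (double L ∸ double j)) (powSum x y (suc (double j))))
    (trans (cong (λ z → 1/ℕ (suc (double j)) * z * pow (x + y) (double L ∸ double j) * powSum x y (suc (double j)))
                 (C*B-odd-vanish r j j≢r))
           (solve 3 (λ f p w → f :* con 0ℚ :* p :* w := con 0ℚ) refl
              (1/ℕ (suc (double j))) (pow (x + y) (double L ∸ double j)) (powSum x y (suc (double j)))))

oddSum-odd : ∀ L r x y → r < L →
  oddSum L (suc (double r)) x y ≡ (- 1/ℕ 2) * pow (x + y) (double L ∸ double r) * powSum x y (suc (double r))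
oddSum-odd L r x y r<L = begin
  oddSum L (suc (double r)) x y
    ≡⟨ sumTo-single L _ r r<L (λ j _ j≢r → oddSumTerm-vanish L r x y j j≢r) ⟩
  1/ℕ m * ℕtoℚ (m C double r) * B (m ∸ double r) * P * W
    ≡⟨ cong₂ (λ c e → 1/ℕ m * ℕtoℚ c * B e * P * W) ([1+n]Cn≡1+n (double r)) (ℕP.m+n∸n≡m 1 (double r)) ⟩
  1/ℕ m * ℕtoℚ m * B 1 * P * W
    ≡⟨ cong (λ t → t * B 1 * P * W) (1/ℕ-inverseˡ (double r)) ⟩
  1ℚ * B 1 * P * W
    ≡⟨ solve 3 (λ b p w → con 1ℚ :* b :* p :* w := b :* p :* w) refl (B 1) P W ⟩
  (- 1/ℕ 2) * P * W ∎
  where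
  open ≡-Reasoning
  m = suc (double r)
  P = pow (x + y) (double L ∸ double r)
  W = powSum x y m

oddSum-top : ∀ L x y → oddSum L (suc (double L)) x y ≡ 0ℚ
oddSum-top L x y = sumTo-zero L _ (λ j j<L → oddSumTerm-vanish L L x y j (ℕP.<⇒≢ j<L))

private
  oddSumTerm-even-≤ : ∀ L r x y j → r ≤ L → j ≤ r →
    ℕtoℚ (suc (double r)) * oddSumTerm L (double r) x y j ≡
      pow (x + y) (double L ∸ double r)
        * (𝔹-term (suc (double r)) (x + y) x (suc (double j)) + 𝔹-term (suc (double r)) (x + y) y (suc (double j)))
  oddSumTerm-even-≤ L r x y j r≤L j≤r = begin
    ℕtoℚ m * (1/ℕ n * ℕtoℚ (double r C double j) * β * pow X (double L ∸ double j) * powSum x y n)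
      ≡⟨ cong (λ e → ℕtoℚ m * (1/ℕ n * ℕtoℚ (double r C double j) * β * pow X e * powSum x y n))
              (∸-split (double-mono-≤ j≤r) (double-mono-≤ r≤L)) ⟩
    ℕtoℚ m * (1/ℕ n * ℕtoℚ (double r C double j) * β * pow X ((double L ∸ double r) ℕ.+ (double r ∸ double j)) * powSum x y n)
      ≡⟨ cong (λ p → ℕtoℚ m * (1/ℕ n * ℕtoℚ (double r C double j) * β * p * powSum x y n))
              (pow-+ X (double L ∸ double r) (double r ∸ double j)) ⟩
    ℕtoℚ m * (1/ℕ n * ℕtoℚ (double r C double j) * β * (Pₗ * Pᵣ) * (pow x n + pow y n))
      ≡⟨ solve 8 (λ a i c b p q u v → a :* (i :* c :* b :* (p :* q) :* (u :+ v)) :=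
                                       p :* ((i :* (a :* c)) :* b :* q :* u :+ (i :* (a :* c)) :* b :* q :* v)) refl
               (ℕtoℚ m) (1/ℕ n) (ℕtoℚ (double r C double j)) β Pₗ Pᵣ (pow x n) (pow y n) ⟩
    Pₗ * (κ * β * Pᵣ * pow x n + κ * β * Pᵣ * pow y n)
      ≡⟨ cong (λ c → Pₗ * (c * β * Pᵣ * pow x n + c * β * Pᵣ * pow y n)) (C-absorption-ℚ (double j) (double r)) ⟨
    Pₗ * (𝔹-term m X x n + 𝔹-term m X y n) ∎
    where
    open ≡-Reasoning
    m = suc (double r)
    n = suc (double j)
    X = x + y
    β = B (double r ∸ double j)
    Pₗ = pow X (double L ∸ double r)
    Pᵣ = pow X (double r ∸ double j)
    κ = 1/ℕ n * (ℕtoℚ m * ℕtoℚ (double r C double j))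

  oddSumTerm-even-> : ∀ L r x y j → r < j →
    ℕtoℚ (suc (double r)) * oddSumTerm L (double r) x y j ≡
      pow (x + y) (double L ∸ double r)
        * (𝔹-term (suc (double r)) (x + y) x (suc (double j)) + 𝔹-term (suc (double r)) (x + y) y (suc (double j)))
  oddSumTerm-even-> L r x y j r<j = begin
    ℕtoℚ m * (1/ℕ n * ℕtoℚ (double r C double j) * β * Pⱼ * powSum x y n)
      ≡⟨ cong (λ c → ℕtoℚ m * (1/ℕ n * ℕtoℚ c * β * Pⱼ * powSum x y n)) (k>n⇒nCk≡0 r<j′) ⟩
    ℕtoℚ m * (1/ℕ n * 0ℚ * β * Pⱼ * powSum x y n)
      ≡⟨ solve 10 (λ a i b p w c e u v v′ → a :* (i :* con 0ℚ :* b :* p :* w) := c :* (con 0ℚ :* e :* u :* v :+ con 0ℚ :* e :* u :* v′)) refl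
               (ℕtoℚ m) (1/ℕ n) β Pⱼ (powSum x y n) Pₗ (B (m ∸ n)) (pow X (m ∸ n)) (pow x n) (pow y n) ⟩
    Pₗ * (0ℚ * B (m ∸ n) * pow X (m ∸ n) * pow x n + 0ℚ * B (m ∸ n) * pow X (m ∸ n) * pow y n)
      ≡⟨ cong (λ c → Pₗ * (ℕtoℚ c * B (m ∸ n) * pow X (m ∸ n) * pow x n + ℕtoℚ c * B (m ∸ n) * pow X (m ∸ n) * pow y n))
              (k>n⇒nCk≡0 (s≤s r<j′)) ⟨
    Pₗ * (𝔹-term m X x n + 𝔹-term m X y n) ∎
    where
    open ≡-Reasoning
    m = suc (double r)
    n = suc (double j)
    X = x + y
    β = B (double r ∸ double j)
    Pₗ = pow X (double L ∸ double r)
    Pⱼ = pow X (double L ∸ double j)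
    r<j′ : double r < double j
    r<j′ = ℕP.<-trans (ℕP.n<1+n (double r)) (1+double-< r<j)

  oddSumTerm-even : ∀ L r x y j → r ≤ L →
    ℕtoℚ (suc (double r)) * oddSumTerm L (double r) x y j ≡
      pow (x + y) (double L ∸ double r)
        * (𝔹-term (suc (double r)) (x + y) x (suc (double j)) + 𝔹-term (suc (double r)) (x + y) y (suc (double j)))
  oddSumTerm-even L r x y j r≤L =
    [ oddSumTerm-even-≤ L r x y j r≤L , oddSumTerm-even-> L r x y j ]′ (ℕP.≤-<-connex j r)

  𝔹-odd-positions : ∀ L r X w → r ≤ L →
    sumTo L (λ j → 𝔹-term (suc (double r)) X w (suc (double j))) ≡
      𝔹 (suc (double r)) X w - 𝔹-term (suc (double r)) X w (double r) - 𝔹-term (suc (double r)) X w (suc (double L))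
  𝔹-odd-positions L r X w r≤L = sym (begin
    𝔹 m X w - t (double r) - t (suc (double L))
      ≡⟨ cong (λ s → s - t (double r) - t (suc (double L))) (trans extend (sumTo-pairs (suc L) t)) ⟩
    sumTo (suc L) (λ j → t (double j) + t (suc (double j))) - t (double r) - t (suc (double L))
      ≡⟨ cong (λ s → s - t (double r) - t (suc (double L))) (sumTo-+ (suc L) (λ j → t (double j)) (λ j → t (suc (double j)))) ⟩
    (sumTo (suc L) (λ j → t (double j)) + (sumTo L (λ j → t (suc (double j))) + t (suc (double L)))) - t (double r) - t (suc (double L))
      ≡⟨ cong (λ s → (s + (sumTo L (λ j → t (suc (double j))) + t (suc (double L)))) - t (double r) - t (suc (double L)))
              (sumTo-single (suc L) (λ j → t (double j)) r (s≤s r≤L) (λ j _ j≢r → even-vanish j j≢r)) ⟩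
    (t (double r) + (sumTo L (λ j → t (suc (double j))) + t (suc (double L)))) - t (double r) - t (suc (double L))
      ≡⟨ solve 3 (λ a s b → (a :+ (s :+ b)) :- a :- b := s) refl (t (double r)) (sumTo L (λ j → t (suc (double j)))) (t (suc (double L))) ⟩
    sumTo L (λ j → t (suc (double j))) ∎)
    where
    open ≡-Reasoning
    m = suc (double r)
    t = 𝔹-term m X w
    extend : 𝔹 m X w ≡ sumTo (double (suc L)) t
    extend = sym (sumTo-extend t (s≤s (s≤s (double-mono-≤ r≤L)))
      (λ a 1+m≤a _ → trans (cong (λ c → ℕtoℚ c * B (m ∸ a) * pow X (m ∸ a) * pow w a) (k>n⇒nCk≡0 1+m≤a))
                          (solve 3 (λ b p q → con 0ℚ :* b :* p :* q := con 0ℚ) refl (B (m ∸ a)) (pow X (m ∸ a)) (pow w a))))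
    even-vanish : ∀ j → ¬ j ≡ r → t (double j) ≡ 0ℚ
    even-vanish j j≢r = trans (cong (λ z → z * pow X (m ∸ double j) * pow w (double j)) (C*B-odd-vanish r j j≢r))
      (solve 2 (λ p q → con 0ℚ :* p :* q := con 0ℚ) refl (pow X (m ∸ double j)) (pow w (double j)))

  𝔹-term-penultimate : ∀ r X w → 𝔹-term (suc (double r)) X w (double r) ≡ ℕtoℚ (suc (double r)) * (- 1/ℕ 2) * X * pow w (double r)
  𝔹-term-penultimate r X w = trans
    (cong₂ (λ c e → ℕtoℚ c * B e * pow X e * pow w (double r)) ([1+n]Cn≡1+n (double r)) (ℕP.m+n∸n≡m 1 (double r)))
    (solve 4 (λ a b x p → a :* b :* (x :* con 1ℚ) :* p := a :* b :* x :* p) refl (ℕtoℚ (suc (double r))) (B 1) X (pow w (double r)))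

  𝔹-odd-positions-pair : ∀ L r x y → r ≤ L →
    sumTo L (λ j → 𝔹-term (suc (double r)) (x + y) x (suc (double j))) + sumTo L (λ j → 𝔹-term (suc (double r)) (x + y) y (suc (double j)))
      ≡ ℕtoℚ (suc (double r)) * 1/ℕ 2 * (x + y) * powSum x y (double r)
        - (𝔹-term (suc (double r)) (x + y) x (suc (double L)) + 𝔹-term (suc (double r)) (x + y) y (suc (double L)))
  𝔹-odd-positions-pair L r x y r≤L = begin
    sumTo L (λ j → 𝔹-term m X x (suc (double j))) + sumTo L (λ j → 𝔹-term m X y (suc (double j)))
      ≡⟨ cong₂ _+_ (𝔹-odd-positions L r X x r≤L) (𝔹-odd-positions L r X y r≤L) ⟩
    (𝔹 m X x - 𝔹-term m X x (double r) - eₓ) + (𝔹 m X y - 𝔹-term m X y (double r) - e_y)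
      ≡⟨ cong₂ (λ b t → (b - t - eₓ) + (𝔹 m X y - 𝔹-term m X y (double r) - e_y))
               (trans (𝔹-reflection m x y) (cong (_* 𝔹 m X y) (sgn-odd r))) (𝔹-term-penultimate r X x) ⟩
    ((- 1ℚ) * 𝔹 m X y - ℕtoℚ m * (- 1/ℕ 2) * X * pow x (double r) - eₓ) + (𝔹 m X y - 𝔹-term m X y (double r) - e_y)
      ≡⟨ cong (λ t → ((- 1ℚ) * 𝔹 m X y - ℕtoℚ m * (- 1/ℕ 2) * X * pow x (double r) - eₓ) + (𝔹 m X y - t - e_y))
              (𝔹-term-penultimate r X y) ⟩
    ((- 1ℚ) * 𝔹 m X y - ℕtoℚ m * (- 1/ℕ 2) * X * pow x (double r) - eₓ) + (𝔹 m X y - ℕtoℚ m * (- 1/ℕ 2) * X * pow y (double r) - e_y)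
      ≡⟨ solve 8 (λ b n h ξ p q e e′ → ((:- con 1ℚ) :* b :- n :* (:- h) :* ξ :* p :- e) :+ (b :- n :* (:- h) :* ξ :* q :- e′)
                                        := n :* h :* ξ :* (p :+ q) :- (e :+ e′)) refl
               (𝔹 m X y) (ℕtoℚ m) (1/ℕ 2) X (pow x (double r)) (pow y (double r)) eₓ e_y ⟩
    ℕtoℚ m * 1/ℕ 2 * X * powSum x y (double r) - (eₓ + e_y) ∎
    where
    open ≡-Reasoning
    m = suc (double r)
    X = x + y
    eₓ = 𝔹-term m X x (suc (double L))
    e_y = 𝔹-term m X y (suc (double L))

oddSum-even : ∀ L r x y → r ≤ L →
  oddSum L (double r) x y ≡
    1/ℕ 2 * pow (x + y) (suc (double L ∸ double r)) * powSum x y (double r)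
    - 1/ℕ (suc (double r)) * pow (x + y) (double L ∸ double r)
      * (𝔹-term (suc (double r)) (x + y) x (suc (double L)) + 𝔹-term (suc (double r)) (x + y) y (suc (double L)))
oddSum-even L r x y r≤L = begin
  oddSum L (double r) x y
    ≡⟨ 1/ℕ-cancelˡ (double r) (oddSum L (double r) x y) ⟨
  1/ℕ m * (ℕtoℚ m * oddSum L (double r) x y)
    ≡⟨ cong (1/ℕ m *_) (trans (*-distribˡ-sumTo L (ℕtoℚ m) (oddSumTerm L (double r) x y))
                              (sumTo-ext L (λ j → oddSumTerm-even L r x y j r≤L))) ⟩
  1/ℕ m * sumTo L (λ j → Pₗ * (h x j + h y j))
    ≡⟨ cong (1/ℕ m *_) (trans (sym (*-distribˡ-sumTo L Pₗ (λ j → h x j + h y j))) (cong (Pₗ *_) (sumTo-+ L (h x) (h y)))) ⟩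
  1/ℕ m * (Pₗ * (sumTo L (h x) + sumTo L (h y)))
    ≡⟨ cong (λ s → 1/ℕ m * (Pₗ * s)) (𝔹-odd-positions-pair L r x y r≤L) ⟩
  1/ℕ m * (Pₗ * (ℕtoℚ m * 1/ℕ 2 * X * powSum x y (double r) - E))
    ≡⟨ solve 7 (λ i p n h ξ w e → i :* (p :* (n :* h :* ξ :* w :- e)) := h :* (ξ :* p) :* w :* (i :* n) :- i :* p :* e) refl
             (1/ℕ m) Pₗ (ℕtoℚ m) (1/ℕ 2) X (powSum x y (double r)) E ⟩
  1/ℕ 2 * (X * Pₗ) * powSum x y (double r) * (1/ℕ m * ℕtoℚ m) - 1/ℕ m * Pₗ * E
    ≡⟨ cong (λ c → 1/ℕ 2 * (X * Pₗ) * powSum x y (double r) * c - 1/ℕ m * Pₗ * E) (1/ℕ-inverseˡ (double r)) ⟩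
  1/ℕ 2 * (X * Pₗ) * powSum x y (double r) * 1ℚ - 1/ℕ m * Pₗ * E
    ≡⟨ cong (_- 1/ℕ m * Pₗ * E) (ℚP.*-identityʳ (1/ℕ 2 * (X * Pₗ) * powSum x y (double r))) ⟩
  1/ℕ 2 * pow X (suc (double L ∸ double r)) * powSum x y (double r) - 1/ℕ m * Pₗ * E ∎
  where
  open ≡-Reasoning
  m = suc (double r)
  X = x + y
  Pₗ = pow X (double L ∸ double r)
  h : ℚ → ℕ → ℚ
  h w j = 𝔹-term m X w (suc (double j))
  E = 𝔹-term m X x (suc (double L)) + 𝔹-term m X y (suc (double L))

data EvenOdd : ℕ → Set where
  even : ∀ t → EvenOdd (double t)
  odd  : ∀ t → EvenOdd (suc (double t))

evenOdd : ∀ n → EvenOdd n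
evenOdd zero = even 0
evenOdd (suc n) with evenOdd n
... | even t = odd t
... | odd t  = even (suc t)

boundaryTerm : ℕ → ℚ → ℚ → ℕ → ℚ
boundaryTerm L x y 0             = 1/ℕ 2 * powSum x y (suc (double L))
boundaryTerm L x y 1             = - (1/ℕ (suc (double L)) * powSum x y (suc (double L)))
boundaryTerm L x y (suc (suc _)) = 0ℚ

private
  module Complement (L : ℕ) (x y : ℚ) where
    d = suc (double L)
    X = x + y

    complement-odd : ∀ t → t ≤ L →
      oddSum L (d ∸ suc (double t)) x y ≡
        1/ℕ 2 * pow X (suc (double t)) * powSum x y (d ∸ suc (double t))
        - 1/ℕ (suc (double (L ∸ t))) * pow X (double t)
          * (𝔹-term (suc (double (L ∸ t))) X x d + 𝔹-term (suc (double (L ∸ t))) X y d)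
    complement-odd t t≤L = begin
      oddSum L (double L ∸ double t) x y
        ≡⟨ cong (λ J → oddSum L J x y) (double-∸ L t) ⟩
      oddSum L (double r) x y
        ≡⟨ oddSum-even L r x y (ℕP.m∸n≤m L t) ⟩
      1/ℕ 2 * pow X (suc (double L ∸ double r)) * powSum x y (double r) - 1/ℕ (suc (double r)) * pow X (double L ∸ double r) * E
        ≡⟨ cong₂ (λ a b → 1/ℕ 2 * pow X (suc a) * powSum x y b - 1/ℕ (suc (double r)) * pow X a * E)
                 (trans (double-∸ L r) (cong double (ℕP.m∸[m∸n]≡n t≤L))) (sym (double-∸ L t)) ⟩
      1/ℕ 2 * pow X (suc (double t)) * powSum x y (double L ∸ double t) - 1/ℕ (suc (double r)) * pow X (double t) * E ∎
      where
      open ≡-Reasoning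
      r = L ∸ t
      E = 𝔹-term (suc (double r)) X x d + 𝔹-term (suc (double r)) X y d

    𝔹-term-top : ∀ w → 𝔹-term d X w d ≡ pow w d
    𝔹-term-top w = trans (cong₂ (λ c e → ℕtoℚ c * B e * pow X e * pow w d) (nCn≡1 d) (ℕP.n∸n≡0 d))
                         (solve 1 (λ p → con 1ℚ :* con 1ℚ :* con 1ℚ :* p := p) refl (pow w d))

    𝔹-term-beyond : ∀ r w → r < L → 𝔹-term (suc (double r)) X w d ≡ 0ℚ
    𝔹-term-beyond r w r<L = trans
      (cong (λ c → ℕtoℚ c * B (suc (double r) ∸ d) * pow X (suc (double r) ∸ d) * pow w d)
            (k>n⇒nCk≡0 (s≤s (ℕP.<⇒≤ (1+double-< r<L)))))
      (solve 3 (λ a b c → con 0ℚ :* a :* b :* c := con 0ℚ) refl (B (suc (double r) ∸ d)) (pow X (suc (double r) ∸ d)) (pow w d))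

    complement : ∀ u → EvenOdd u → u ≤ d →
      oddSum L (d ∸ u) x y ≡ (- 1/ℕ 2) * sgn u * pow X u * powSum x y (d ∸ u) + boundaryTerm L x y u
    complement .(double 0) (even zero) _ = trans (oddSum-top L x y)
      (solve 2 (λ h w → con 0ℚ := (:- h) :* con 1ℚ :* con 1ℚ :* w :+ h :* w) refl (1/ℕ 2) (powSum x y d))
    complement .(double (suc t)) (even (suc t)) u≤d = begin
      oddSum L (d ∸ double (suc t)) x y
        ≡⟨ cong (λ J → oddSum L J x y) d∸u≡1+2r ⟩
      oddSum L (suc (double r)) x y
        ≡⟨ oddSum-odd L r x y (ℕP.∸-monoʳ-< {L} {suc t} {0} (s≤s z≤n) 1+t≤L) ⟩
      (- 1/ℕ 2) * pow X (double L ∸ double r) * powSum x y (suc (double r))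
        ≡⟨ cong₂ (λ a b → (- 1/ℕ 2) * pow X a * powSum x y b)
                 (trans (double-∸ L r) (cong double (ℕP.m∸[m∸n]≡n 1+t≤L))) (sym d∸u≡1+2r) ⟩
      (- 1/ℕ 2) * pow X (double (suc t)) * powSum x y (d ∸ double (suc t))
        ≡⟨ solve 3 (λ h p w → (:- h) :* p :* w := (:- h) :* con 1ℚ :* p :* w :+ con 0ℚ) refl
                 (1/ℕ 2) (pow X (double (suc t))) (powSum x y (d ∸ double (suc t))) ⟩
      (- 1/ℕ 2) * 1ℚ * pow X (double (suc t)) * powSum x y (d ∸ double (suc t)) + 0ℚ
        ≡⟨ cong (λ s → (- 1/ℕ 2) * s * pow X (double (suc t)) * powSum x y (d ∸ double (suc t)) + 0ℚ) (sgn-double (suc t)) ⟨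
      (- 1/ℕ 2) * sgn (double (suc t)) * pow X (double (suc t)) * powSum x y (d ∸ double (suc t)) + 0ℚ ∎
      where
      open ≡-Reasoning
      1+t≤L : suc t ≤ L
      1+t≤L = double-cancel-≤ u≤d
      r = L ∸ suc t
      d∸u≡1+2r : d ∸ double (suc t) ≡ suc (double r)
      d∸u≡1+2r = 1+double-∸ 1+t≤L
    complement .(suc (double zero)) (odd zero) _ = trans (complement-odd 0 z≤n) (trans
      (cong₂ (λ a b → 1/ℕ 2 * pow X 1 * powSum x y (double L) - 1/ℕ d * 1ℚ * (a + b)) (𝔹-term-top x) (𝔹-term-top y))
      (solve 4 (λ h ξ w i → h :* ξ :* w :- i :* con 1ℚ :* powSum′ := (:- h) :* (:- con 1ℚ) :* ξ :* w :+ (:- (i :* powSum′))) refl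
         (1/ℕ 2) (pow X 1) (powSum x y (double L)) (1/ℕ d)))
      where powSum′ = con (powSum x y d)
    complement .(suc (double (suc t))) (odd (suc t)) u≤d = trans (complement-odd (suc t) 1+t≤L) (trans
      (cong₂ (λ a b → 1/ℕ 2 * P * W - 1/ℕ (suc (double r)) * pow X (double (suc t)) * (a + b))
             (𝔹-term-beyond r x r<L) (𝔹-term-beyond r y r<L))
      (trans (solve 4 (λ h p w c → h :* p :* w :- c :* (con 0ℚ :+ con 0ℚ) := (:- h) :* (:- con 1ℚ) :* p :* w :+ con 0ℚ) refl
                (1/ℕ 2) P W (1/ℕ (suc (double r)) * pow X (double (suc t))))
             (cong (λ s → (- 1/ℕ 2) * s * P * W + 0ℚ) (sym (sgn-odd (suc t))))))
      where
      1+t≤L : suc t ≤ L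
      1+t≤L = double-cancel-≤ (ℕP.m≤n⇒m≤1+n (ℕP.≤-pred u≤d))
      r = L ∸ suc t
      r<L : r < L
      r<L = ℕP.∸-monoʳ-< {L} {suc t} {0} (s≤s z≤n) 1+t≤L
      P = pow X (suc (double (suc t)))
      W = powSum x y (d ∸ suc (double (suc t)))

oddSum-complement : ∀ L u x y → u ≤ suc (double L) →
  oddSum L (suc (double L) ∸ u) x y ≡
    (- 1/ℕ 2) * sgn u * pow (x + y) u * powSum x y (suc (double L) ∸ u) + boundaryTerm L x y u
oddSum-complement L u x y = Complement.complement L x y u (evenOdd u)

-- The identities for F, G and R

-- The inner sum of F_k^{(i)} at s = j + 1, where k − 2s = 2L + 1 − 2j.
innerSum : ℕ → ℕ → ℕ → ℚ
innerSum L i j = sumTo (suc (suc (double L) ∸ double j))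
  (λ n → ℕtoℚ (i C (suc (double L) ∸ double j ∸ n)) * ℕtoℚ ((n ℕ.+ double j) C n) * B n)

F-as-innerSum : ∀ L i X Y → F (suc L) i X Y ≡
  sumTo L (λ j → (- (ℕtoℚ 2 * 1/ℕ (suc (double j)))) * innerSum L i j * pow X (double L ∸ double j) * pow Y (suc (double j)))
F-as-innerSum L i X Y = sumTo-ext L (λ j → trans (cong₂ summand (2*≡double (suc j)) (2*≡double (suc L))) (rewrite-summand j))
  where
  summand : ℕ → ℕ → ℚ
  summand a b = (frac (ℤ.- (+ 2)) (a ∸ 1)
    * sumTo (suc (suc b ∸ a)) (λ n → ℕtoℚ (i C (suc b ∸ a ∸ n)) * ℕtoℚ ((n ℕ.+ a ∸ 2) C n) * B n))
    * pow X (b ∸ a) * pow Y (a ∸ 1)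
  rewrite-summand : ∀ j → summand (double (suc j)) (double (suc L)) ≡
    (- (ℕtoℚ 2 * 1/ℕ (suc (double j)))) * innerSum L i j * pow X (double L ∸ double j) * pow Y (suc (double j))
  rewrite-summand j = cong₂ (λ c s → c * s * pow X (double L ∸ double j) * pow Y (suc (double j)))
    (cong -_ (frac-split (+ 2) (double j)))
    (sumTo-ext (suc (suc (double L) ∸ double j))
      (λ n → cong (λ m → ℕtoℚ (i C (suc (double L) ∸ double j ∸ n)) * ℕtoℚ (m C n) * B n)
                  (cong (_∸ 2) (trans (ℕP.+-suc n (suc (double j))) (cong suc (ℕP.+-suc n (double j)))))))

innerSum-reverse : ∀ L i j → j ≤ L → innerSum L i j ≡
  sumTo (suc (suc (double L))) (λ u → ℕtoℚ (i C u) * ℕtoℚ ((suc (double L) ∸ u) C double j) * B (suc (double L) ∸ u ∸ double j))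
innerSum-reverse L i j j≤L = begin
  innerSum L i j
    ≡⟨ sumTo-reverse (suc e) (λ n → ℕtoℚ (i C (e ∸ n)) * ℕtoℚ ((n ℕ.+ double j) C n) * B n) ⟩
  sumTo (suc e) (λ u → ℕtoℚ (i C (e ∸ (e ∸ u))) * ℕtoℚ (((e ∸ u) ℕ.+ double j) C (e ∸ u)) * B (e ∸ u))
    ≡⟨ sumTo-cong (suc e) (λ u u<1+e → reindex u (ℕP.≤-pred u<1+e)) ⟩
  sumTo (suc e) t
    ≡⟨ sumTo-extend t (s≤s (ℕP.m∸n≤m d (double j))) beyond ⟨
  sumTo (suc d) t ∎
  where
  open ≡-Reasoning
  d = suc (double L)
  e = d ∸ double j
  t = λ u → ℕtoℚ (i C u) * ℕtoℚ ((d ∸ u) C double j) * B (d ∸ u ∸ double j)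
  2j≤d : double j ≤ d
  2j≤d = ℕP.m≤n⇒m≤1+n (double-mono-≤ j≤L)
  reindex : ∀ u → u ≤ e → ℕtoℚ (i C (e ∸ (e ∸ u))) * ℕtoℚ (((e ∸ u) ℕ.+ double j) C (e ∸ u)) * B (e ∸ u) ≡ t u
  reindex u u≤e = begin
    ℕtoℚ (i C (e ∸ (e ∸ u))) * ℕtoℚ (((e ∸ u) ℕ.+ double j) C (e ∸ u)) * B (e ∸ u)
      ≡⟨ cong₂ (λ a b → ℕtoℚ (i C a) * ℕtoℚ (b C (e ∸ u)) * B (e ∸ u)) (ℕP.m∸[m∸n]≡n u≤e) e∸u+2j≡d∸u ⟩
    ℕtoℚ (i C u) * ℕtoℚ ((d ∸ u) C (e ∸ u)) * B (e ∸ u)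
      ≡⟨ cong (λ a → ℕtoℚ (i C u) * ℕtoℚ ((d ∸ u) C a) * B a) e∸u≡d∸u∸2j ⟩
    ℕtoℚ (i C u) * ℕtoℚ ((d ∸ u) C (d ∸ u ∸ double j)) * B (d ∸ u ∸ double j)
      ≡⟨ cong (λ c → ℕtoℚ (i C u) * ℕtoℚ c * B (d ∸ u ∸ double j)) (nCk≡nC[n∸k] 2j≤d∸u) ⟨
    t u ∎
    where
    e∸u+2j≡d∸u : (e ∸ u) ℕ.+ double j ≡ d ∸ u
    e∸u+2j≡d∸u = trans (sym (ℕP.+-∸-comm (double j) u≤e)) (cong (_∸ u) (ℕP.m∸n+n≡m 2j≤d))
    e∸u≡d∸u∸2j : e ∸ u ≡ d ∸ u ∸ double j
    e∸u≡d∸u∸2j = trans (ℕP.∸-+-assoc d (double j) u)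
                   (trans (cong (d ∸_) (ℕP.+-comm (double j) u)) (sym (ℕP.∸-+-assoc d u (double j))))
    2j≤d∸u : double j ≤ d ∸ u
    2j≤d∸u = subst (double j ≤_) e∸u+2j≡d∸u (ℕP.m≤n+m (double j) (e ∸ u))
  beyond : ∀ u → suc e ≤ u → u < suc d → t u ≡ 0ℚ
  beyond u e<u u≤d = trans (cong (λ c → ℕtoℚ (i C u) * ℕtoℚ c * B (d ∸ u ∸ double j)) (k>n⇒nCk≡0 d∸u<2j))
    (solve 2 (λ a b → a :* con 0ℚ :* b := con 0ℚ) refl (ℕtoℚ (i C u)) (B (d ∸ u ∸ double j)))
    where
    d∸u<2j : d ∸ u < double j
    d∸u<2j = subst (d ∸ u <_) (ℕP.m∸[m∸n]≡n 2j≤d) (ℕP.∸-monoʳ-< e<u (ℕP.≤-pred u≤d))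

F-pair≡oddSums : ∀ L i x y → F (suc L) i (x + y) x + F (suc L) i (x + y) y ≡
  sumTo (suc (suc (double L))) (λ u → (- ℕtoℚ 2) * ℕtoℚ (i C u) * oddSum L (suc (double L) ∸ u) x y)
F-pair≡oddSums L i x y = begin
  F (suc L) i X x + F (suc L) i X y
    ≡⟨ cong₂ _+_ (F-as-innerSum L i X x) (F-as-innerSum L i X y) ⟩
  sumTo L (λ j → c j * innerSum L i j * P j * pow x (m j)) + sumTo L (λ j → c j * innerSum L i j * P j * pow y (m j))
    ≡⟨ sumTo-+ L _ _ ⟨
  sumTo L (λ j → c j * innerSum L i j * P j * pow x (m j) + c j * innerSum L i j * P j * pow y (m j))
    ≡⟨ sumTo-cong L (λ j j<L → collect j (ℕP.<⇒≤ j<L)) ⟩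
  sumTo L (λ j → sumTo (suc d) (λ u → (- ℕtoℚ 2) * ℕtoℚ (i C u) * oddSumTerm L (d ∸ u) x y j))
    ≡⟨ sumTo-swap L (suc d) _ ⟩
  sumTo (suc d) (λ u → sumTo L (λ j → (- ℕtoℚ 2) * ℕtoℚ (i C u) * oddSumTerm L (d ∸ u) x y j))
    ≡⟨ sumTo-ext (suc d) (λ u → sym (*-distribˡ-sumTo L ((- ℕtoℚ 2) * ℕtoℚ (i C u)) (oddSumTerm L (d ∸ u) x y))) ⟩
  sumTo (suc d) (λ u → (- ℕtoℚ 2) * ℕtoℚ (i C u) * oddSum L (d ∸ u) x y) ∎
  where
  open ≡-Reasoning
  X = x + y
  d = suc (double L)
  m : ℕ → ℕ
  m j = suc (double j)
  c : ℕ → ℚ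
  c j = - (ℕtoℚ 2 * 1/ℕ (m j))
  P : ℕ → ℚ
  P j = pow X (double L ∸ double j)
  collect : ∀ j → j ≤ L →
    c j * innerSum L i j * P j * pow x (m j) + c j * innerSum L i j * P j * pow y (m j) ≡
      sumTo (suc d) (λ u → (- ℕtoℚ 2) * ℕtoℚ (i C u) * oddSumTerm L (d ∸ u) x y j)
  collect j j≤L = begin
    c j * innerSum L i j * P j * pow x (m j) + c j * innerSum L i j * P j * pow y (m j)
      ≡⟨ solve 5 (λ c n p a b → c :* n :* p :* a :+ c :* n :* p :* b := (c :* p :* (a :+ b)) :* n) refl
               (c j) (innerSum L i j) (P j) (pow x (m j)) (pow y (m j)) ⟩
    (c j * P j * powSum x y (m j)) * innerSum L i j
      ≡⟨ cong ((c j * P j * powSum x y (m j)) *_) (innerSum-reverse L i j j≤L) ⟩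
    (c j * P j * powSum x y (m j)) * sumTo (suc d) _
      ≡⟨ *-distribˡ-sumTo (suc d) (c j * P j * powSum x y (m j)) _ ⟩
    sumTo (suc d) _
      ≡⟨ sumTo-ext (suc d) (λ u → solve 7 (λ t i p w a b β → (:- (t :* i)) :* p :* w :* (a :* b :* β) := (:- t) :* a :* (i :* b :* β :* p :* w)) refl
               (ℕtoℚ 2) (1/ℕ (m j)) (P j) (powSum x y (m j)) (ℕtoℚ (i C u)) (ℕtoℚ ((d ∸ u) C double j)) (B (d ∸ u ∸ double j))) ⟩
    sumTo (suc d) (λ u → (- ℕtoℚ 2) * ℕtoℚ (i C u) * oddSumTerm L (d ∸ u) x y j) ∎

-- R_k^{(i)} for k = 2L + 3, with the coefficient −(k−2−2i)/(k−2) written as −1 + 2i/(k−2).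
R′ : ℕ → ℕ → ℚ → ℚ → ℚ
R′ L i x y = sgn i * pow x (suc (double L) ∸ i) * pow y i + sgn i * pow x i * pow y (suc (double L) ∸ i)
             + ((- 1ℚ) + ℕtoℚ 2 * ℕtoℚ i * 1/ℕ (suc (double L))) * powSum x y (suc (double L))

boundaryTerm-sum : ∀ L i x y →
  sumTo (suc (suc (double L))) (λ u → (- ℕtoℚ 2) * ℕtoℚ (i C u) * boundaryTerm L x y u) ≡
    ((- 1ℚ) + ℕtoℚ 2 * ℕtoℚ i * 1/ℕ (suc (double L))) * powSum x y (suc (double L))
boundaryTerm-sum L i x y = begin
  sumTo (suc (suc (double L))) g
    ≡⟨ trans (sumTo-sucˡ (suc (double L)) g) (cong (λ s → g 0 + s) (sumTo-sucˡ (double L) (λ u → g (suc u)))) ⟩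
  g 0 + (g 1 + sumTo (double L) (λ u → g (suc (suc u))))
    ≡⟨ cong (λ t → g 0 + (g 1 + t)) (sumTo-zero (double L) _ (λ u _ → ℚP.*-zeroʳ ((- ℕtoℚ 2) * ℕtoℚ (i C suc (suc u))))) ⟩
  g 0 + (g 1 + 0ℚ)
    ≡⟨ cong (λ c → g 0 + ((- ℕtoℚ 2) * ℕtoℚ c * boundaryTerm L x y 1 + 0ℚ)) (nC1≡n i) ⟩
  (- ℕtoℚ 2) * 1ℚ * (1/ℕ 2 * W) + ((- ℕtoℚ 2) * ℕtoℚ i * (- (1/ℕ d * W)) + 0ℚ)
    ≡⟨ solve 5 (λ t h w n i → (:- t) :* con 1ℚ :* (h :* w) :+ ((:- t) :* n :* (:- (i :* w)) :+ con 0ℚ)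
                             := (:- (h :* t) :+ t :* n :* i) :* w) refl (ℕtoℚ 2) (1/ℕ 2) W (ℕtoℚ i) (1/ℕ d) ⟩
  ((- (1/ℕ 2 * ℕtoℚ 2)) + ℕtoℚ 2 * ℕtoℚ i * 1/ℕ d) * W
    ≡⟨ cong (λ t → ((- t) + ℕtoℚ 2 * ℕtoℚ i * 1/ℕ d) * W) (1/ℕ-inverseˡ 1) ⟩
  ((- 1ℚ) + ℕtoℚ 2 * ℕtoℚ i * 1/ℕ d) * W ∎
  where
  open ≡-Reasoning
  d = suc (double L)
  W = powSum x y d
  g = λ u → (- ℕtoℚ 2) * ℕtoℚ (i C u) * boundaryTerm L x y u

F-pair≡R′ : ∀ L i → i ≤ suc (double L) → ∀ x y → F (suc L) i (x + y) x + F (suc L) i (x + y) y ≡ R′ L i x y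
F-pair≡R′ L i i≤d x y = begin
  F (suc L) i X x + F (suc L) i X y
    ≡⟨ F-pair≡oddSums L i x y ⟩
  sumTo (suc d) (λ u → (- ℕtoℚ 2) * ℕtoℚ (i C u) * oddSum L (d ∸ u) x y)
    ≡⟨ sumTo-cong (suc d) (λ u u<1+d → split u (ℕP.≤-pred u<1+d)) ⟩
  sumTo (suc d) (λ u → (a x u + a y u) + b u)
    ≡⟨ trans (sumTo-+ (suc d) _ b) (cong (_+ sumTo (suc d) b) (sumTo-+ (suc d) (a x) (a y))) ⟩
  (sumTo (suc d) (a x) + sumTo (suc d) (a y)) + sumTo (suc d) b
    ≡⟨ cong₂ _+_ (cong₂ _+_ (binomial-alternating i d x y i≤d)
                            (trans (sumTo-ext (suc d) (λ u → cong (λ s → ℕtoℚ (i C u) * sgn u * pow s u * pow y (d ∸ u)) (ℚP.+-comm x y)))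
                                   (binomial-alternating i d y x i≤d)))
                 (boundaryTerm-sum L i x y) ⟩
  (sgn i * pow x (d ∸ i) * pow y i + sgn i * pow y (d ∸ i) * pow x i) + ((- 1ℚ) + ℕtoℚ 2 * ℕtoℚ i * 1/ℕ d) * powSum x y d
    ≡⟨ cong (λ t → (sgn i * pow x (d ∸ i) * pow y i + t) + ((- 1ℚ) + ℕtoℚ 2 * ℕtoℚ i * 1/ℕ d) * powSum x y d)
            (solve 3 (λ s a b → s :* a :* b := s :* b :* a) refl (sgn i) (pow y (d ∸ i)) (pow x i)) ⟩
  R′ L i x y ∎
  where
  open ≡-Reasoning
  X = x + y
  d = suc (double L)
  a : ℚ → ℕ → ℚ
  a w u = ℕtoℚ (i C u) * sgn u * pow X u * pow w (d ∸ u)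
  b : ℕ → ℚ
  b u = (- ℕtoℚ 2) * ℕtoℚ (i C u) * boundaryTerm L x y u
  split : ∀ u → u ≤ d → (- ℕtoℚ 2) * ℕtoℚ (i C u) * oddSum L (d ∸ u) x y ≡ (a x u + a y u) + b u
  split u u≤d = begin
    (- ℕtoℚ 2) * ℕtoℚ (i C u) * oddSum L (d ∸ u) x y
      ≡⟨ cong ((- ℕtoℚ 2) * ℕtoℚ (i C u) *_) (oddSum-complement L u x y u≤d) ⟩
    (- ℕtoℚ 2) * ℕtoℚ (i C u) * ((- 1/ℕ 2) * sgn u * pow X u * (pow x (d ∸ u) + pow y (d ∸ u)) + boundaryTerm L x y u)
      ≡⟨ solve 8 (λ t c h s p v w e → (:- t) :* c :* ((:- h) :* s :* p :* (v :+ w) :+ e)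
                                       := (h :* t) :* (c :* s :* p :* v :+ c :* s :* p :* w) :+ (:- t) :* c :* e) refl
               (ℕtoℚ 2) (ℕtoℚ (i C u)) (1/ℕ 2) (sgn u) (pow X u) (pow x (d ∸ u)) (pow y (d ∸ u)) (boundaryTerm L x y u) ⟩
    (1/ℕ 2 * ℕtoℚ 2) * (a x u + a y u) + b u
      ≡⟨ cong (λ t → t * (a x u + a y u) + b u) (1/ℕ-inverseˡ 1) ⟩
    1ℚ * (a x u + a y u) + b u
      ≡⟨ cong (_+ b u) (ℚP.*-identityˡ (a x u + a y u)) ⟩
    (a x u + a y u) + b u ∎

R′-complement : ∀ L i → i ≤ suc (double L) → ∀ x y → - R′ L (suc (double L) ∸ i) x y ≡ R′ L i x y
R′-complement L i i≤d x y = begin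
  - R′ L i′ x y
    ≡⟨ cong₂ (λ e c → - (sgn i′ * pow x e * pow y i′ + sgn i′ * pow x i′ * pow y e + ((- 1ℚ) + ℕtoℚ 2 * c * 1/ℕ d) * powSum x y d))
             (ℕP.m∸[m∸n]≡n i≤d) ℕtoℚ-i′ ⟩
  - (sgn i′ * pow x i * pow y i′ + sgn i′ * pow x i′ * pow y i + ((- 1ℚ) + ℕtoℚ 2 * (ℕtoℚ d - ℕtoℚ i) * 1/ℕ d) * powSum x y d)
    ≡⟨ cong (λ s → - (s * pow x i * pow y i′ + s * pow x i′ * pow y i + ((- 1ℚ) + ℕtoℚ 2 * (ℕtoℚ d - ℕtoℚ i) * 1/ℕ d) * powSum x y d))
            sgn-i′ ⟩
  - ((- sgn i) * pow x i * pow y i′ + (- sgn i) * pow x i′ * pow y i + ((- 1ℚ) + ℕtoℚ 2 * (ℕtoℚ d - ℕtoℚ i) * 1/ℕ d) * powSum x y d)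
    ≡⟨ solve 9 (λ s a b c e n m f w →
          :- ((:- s) :* a :* b :+ (:- s) :* c :* e :+ ((:- con 1ℚ) :+ con (ℕtoℚ 2) :* (n :- m) :* f) :* w)
          := (s :* c :* e :+ s :* a :* b :+ ((:- con 1ℚ) :+ con (ℕtoℚ 2) :* m :* f) :* w) :+ (con (ℕtoℚ 2) :- con (ℕtoℚ 2) :* (f :* n)) :* w) refl
          (sgn i) (pow x i) (pow y i′) (pow x i′) (pow y i) (ℕtoℚ d) (ℕtoℚ i) (1/ℕ d) (powSum x y d) ⟩
  R′ L i x y + (ℕtoℚ 2 - ℕtoℚ 2 * (1/ℕ d * ℕtoℚ d)) * powSum x y d
    ≡⟨ cong (λ t → R′ L i x y + (ℕtoℚ 2 - ℕtoℚ 2 * t) * powSum x y d) (1/ℕ-inverseˡ (double L)) ⟩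
  R′ L i x y + (ℕtoℚ 2 - ℕtoℚ 2 * 1ℚ) * powSum x y d
    ≡⟨ solve 3 (λ r t w → r :+ (t :- t :* con 1ℚ) :* w := r) refl (R′ L i x y) (ℕtoℚ 2) (powSum x y d) ⟩
  R′ L i x y ∎
  where
  open ≡-Reasoning
  d = suc (double L)
  i′ = d ∸ i
  ℕtoℚ-i′ : ℕtoℚ i′ ≡ ℕtoℚ d - ℕtoℚ i
  ℕtoℚ-i′ = trans (solve 2 (λ a b → a := (b :+ a) :- b) refl (ℕtoℚ i′) (ℕtoℚ i))
                  (cong (_- ℕtoℚ i) (trans (sym (ℕtoℚ-+ i i′)) (cong ℕtoℚ (ℕP.m+[n∸m]≡n i≤d))))
  sgn-i′ : sgn i′ ≡ - sgn i
  sgn-i′ = begin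
    sgn i′                   ≡⟨ solve 1 (λ a → a := a :* con 1ℚ) refl (sgn i′) ⟩
    sgn i′ * 1ℚ              ≡⟨ cong (sgn i′ *_) (sgn-square i) ⟨
    sgn i′ * (sgn i * sgn i) ≡⟨ solve 2 (λ a b → a :* (b :* b) := (b :* a) :* b) refl (sgn i′) (sgn i) ⟩
    (sgn i * sgn i′) * sgn i ≡⟨ cong (_* sgn i) (trans (sym (sgn-+ i i′)) (trans (cong sgn (ℕP.m+[n∸m]≡n i≤d)) (sgn-odd L))) ⟩
    (- 1ℚ) * sgn i          ≡⟨ solve 1 (λ a → (:- con 1ℚ) :* a := :- a) refl (sgn i) ⟩
    - sgn i                  ∎

G≡-F : ∀ K i X Y → G K i X Y ≡ - F K (kOf K ∸ 2 ∸ i) X Y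
G≡-F K i X Y = sym (trans (neg-distrib-sumTo (K ∸ 1) _) (sumTo-ext (K ∸ 1) (λ j →
  trans (cong (λ c → - (c * inner (kOf K) (kOf K ∸ 2 ∸ i) (suc j) * pow X (2 ℕ.* K ∸ 2 ℕ.* suc j) * pow Y (2 ℕ.* suc j ∸ 1)))
              (frac-neg 1 (2 ℕ.* suc j ∸ 1)))
  (solve 4 (λ f n p q → :- (((:- f) :* n) :* p :* q) := (f :* n) :* p :* q) refl
    (frac (+ 2) (2 ℕ.* suc j ∸ 1)) (inner (kOf K) (kOf K ∸ 2 ∸ i) (suc j))
    (pow X (2 ℕ.* K ∸ 2 ℕ.* suc j)) (pow Y (2 ℕ.* suc j ∸ 1))))))

kOf∸2 : ∀ L → kOf (suc L) ∸ 2 ≡ suc (double L)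
kOf∸2 L = cong (λ n → suc n ∸ 2) (2*≡double (suc L))

R≡R′ : ∀ L i x y → R (suc L) i x y ≡ R′ L i x y
R≡R′ L i x y = trans (cong (λ D → R-at D) (kOf∸2 L)) (begin
  R-at d
    ≡⟨ cong (λ c → (- c) * pow x d + sgn i * pow x (d ∸ i) * pow y i + sgn i * pow x i * pow y (d ∸ i) - c * pow y d) c≡ ⟩
  (- ((ℕtoℚ d - ℕtoℚ 2 * ℕtoℚ i) * 1/ℕ d)) * pow x d + sgn i * pow x (d ∸ i) * pow y i + sgn i * pow x i * pow y (d ∸ i)
    - ((ℕtoℚ d - ℕtoℚ 2 * ℕtoℚ i) * 1/ℕ d) * pow y d
    ≡⟨ solve 11 (λ n t m f p q s a b c e → (:- ((n :- t :* m) :* f)) :* p :+ s :* a :* b :+ s :* c :* e :- ((n :- t :* m) :* f) :* q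
                                       := s :* a :* b :+ s :* c :* e :+ ((:- (f :* n)) :+ t :* m :* f) :* (p :+ q)) refl
             (ℕtoℚ d) (ℕtoℚ 2) (ℕtoℚ i) (1/ℕ d) (pow x d) (pow y d) (sgn i) (pow x (d ∸ i)) (pow y i) (pow x i) (pow y (d ∸ i)) ⟩
  sgn i * pow x (d ∸ i) * pow y i + sgn i * pow x i * pow y (d ∸ i) + ((- (1/ℕ d * ℕtoℚ d)) + ℕtoℚ 2 * ℕtoℚ i * 1/ℕ d) * powSum x y d
    ≡⟨ cong (λ t → sgn i * pow x (d ∸ i) * pow y i + sgn i * pow x i * pow y (d ∸ i) + ((- t) + ℕtoℚ 2 * ℕtoℚ i * 1/ℕ d) * powSum x y d)
            (1/ℕ-inverseˡ (double L)) ⟩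
  R′ L i x y ∎)
  where
  open ≡-Reasoning
  d = suc (double L)
  c : ℕ → ℚ
  c D = frac (+ D ℤ.- + (2 ℕ.* i)) D
  R-at : ℕ → ℚ
  R-at D = (- c D) * pow x D + sgn i * pow x (D ∸ i) * pow y i + sgn i * pow x i * pow y (D ∸ i) - c D * pow y D
  c≡ : c d ≡ (ℕtoℚ d - ℕtoℚ 2 * ℕtoℚ i) * 1/ℕ d
  c≡ = trans (frac-split (+ d ℤ.- + (2 ℕ.* i)) (double L))
             (cong (_* 1/ℕ d) (trans (/1-homo-∸ d (2 ℕ.* i)) (cong (λ t → ℕtoℚ d - t) (ℕtoℚ-* 2 i))))

G-pair≡R′ : ∀ L i → i ≤ suc (double L) → ∀ x y → G (suc L) i (x + y) x + G (suc L) i (x + y) y ≡ R′ L i x y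
G-pair≡R′ L i i≤d x y = begin
  G (suc L) i (x + y) x + G (suc L) i (x + y) y
    ≡⟨ cong₂ _+_ (G≡-F-complement x) (G≡-F-complement y) ⟩
  - F (suc L) (d ∸ i) (x + y) x + - F (suc L) (d ∸ i) (x + y) y
    ≡⟨ ℚP.neg-distrib-+ (F (suc L) (d ∸ i) (x + y) x) (F (suc L) (d ∸ i) (x + y) y) ⟨
  - (F (suc L) (d ∸ i) (x + y) x + F (suc L) (d ∸ i) (x + y) y)
    ≡⟨ cong -_ (F-pair≡R′ L (d ∸ i) (ℕP.m∸n≤m d i) x y) ⟩
  - R′ L (d ∸ i) x y
    ≡⟨ R′-complement L i i≤d x y ⟩
  R′ L i x y ∎
  where
  open ≡-Reasoning
  d = suc (double L)
  G≡-F-complement : ∀ w → G (suc L) i (x + y) w ≡ - F (suc L) (d ∸ i) (x + y) w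
  G≡-F-complement w = trans (G≡-F (suc L) i (x + y) w) (cong (λ j → - F (suc L) (j ∸ i) (x + y) w) (kOf∸2 L))

theorem2 : (K i : ℕ) → 2 ≤ K → i ≤ kOf K ∸ 2 → (x y : ℚ) →
    (F K i (x + y) x + F K i (x + y) y ≡ R K i x y)
    × (G K i (x + y) x + G K i (x + y) y ≡ R K i x y)
-- 2 ≤ K only excludes K = 0, where k − 2 is truncated and the identity fails; K = 1 needs no separate case.
theorem2 (suc L) i _ i≤k-2 x y =
  trans (F-pair≡R′ L i i≤d x y) (sym (R≡R′ L i x y)) ,
  trans (G-pair≡R′ L i i≤d x y) (sym (R≡R′ L i x y))
  where
  i≤d : i ≤ suc (double L)
  i≤d = subst (i ≤_) (kOf∸2 L) i≤k-2
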